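{- For every positive integer $n$, the set of sizes of the orbits of ${\rm Aut}(\Lambda_n)$ acting on $E(\Lambda_n)$ is contained in $\{n,2n\}$, and it equals $\{n,2n\}$ if and only if $n\ge 5$.
   Context: A Lucas string of length $n$ is a binary string $u_1\cdots u_n$ with no two consecutive 1s and not both $u_1=1$ and $u_n=1$. The Lucas cube $\Lambda_n$ is the subgraph of the $n$-cube $Q_n$ (binary strings of length $n$, adjacent iff they differ in exactly one position) induced by the Lucas strings of length $n$. ${\rm Aut}(\Lambda_n)$ acts on edges by $\{u,v\}\mapsto\{g(u),g(v)\}$. -}

module Defs where

open import Data.Bool using (Bool; true; false; not; _∧_; T)
open import Data.Nat using (ℕ; zero; suc; _+_; _*_; _≤_)
open import Data.Vec using (Vec; []; _∷_; lookup; last)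
open import Data.Fin using (Fin)
open import Data.Product using (Σ; ∃; _×_; _,_; proj₁)
open import Data.Sum using (_⊎_)
open import Data.List using (List; length)
open import Data.List.Membership.Propositional using (_∈_)
open import Data.List.Relation.Unary.Unique.Propositional using (Unique)
open import Function.Bundles using (_↔_; _⇔_; Inverse)
open import Relation.Binary.PropositionalEquality using (_≡_)

Word : ℕ → Set
Word n = Vec Bool n

noConsec : ∀ {n} → Word n → Bool
noConsec [] = true
noConsec (x ∷ []) = true
noConsec (x ∷ y ∷ xs) = not (x ∧ y) ∧ noConsec (y ∷ xs)

isLucas : ∀ {n} → Word n → Bool
isLucas [] = true
isLucas (x ∷ xs) = noConsec (x ∷ xs) ∧ not (x ∧ last (x ∷ xs))

LV : ℕ → Set
LV n = Σ (Word n) (λ u → T (isLucas u))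

hamming : ∀ {n} → Word n → Word n → ℕ
hamming [] [] = 0
hamming (x ∷ xs) (y ∷ ys) with x | y
... | true  | true  = hamming xs ys
... | false | false = hamming xs ys
... | _     | _     = suc (hamming xs ys)

Adj : ∀ {n} → LV n → LV n → Set
Adj u v = hamming (proj₁ u) (proj₁ v) ≡ 1

record Aut (n : ℕ) : Set where
  field
    perm     : LV n ↔ LV n
    preserve : ∀ u v → Adj u v ⇔ Adj (Inverse.to perm u) (Inverse.to perm v)

act : ∀ {n} → Aut n → LV n → LV n
act g = Inverse.to (Aut.perm g)

Below : ∀ {n} → LV n → LV n → Set
Below {n} u v = ∀ (i : Fin n) → lookup (proj₁ u) i ≡ true → lookup (proj₁ v) i ≡ true

-- an edge {u,v} of Λ_n, represented by the unique ordered pair (u , v) with u ≤ v bitwise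
IsEdge : ∀ {n} → LV n × LV n → Set
IsEdge (u , v) = Adj u v × Below u v

InOrbit : ∀ {n} → LV n × LV n → LV n × LV n → Set
InOrbit {n} (u , v) (u' , v') =
  ∃ λ (g : Aut n) → (act g u ≡ u' × act g v ≡ v') ⊎ (act g u ≡ v' × act g v ≡ u')

OrbitSize : ∀ {n} → LV n × LV n → ℕ → Set
OrbitSize {n} e k =
  ∃ λ (L : List (LV n × LV n)) →
    Unique L × length L ≡ k × (∀ p → (p ∈ L) ⇔ (IsEdge p × InOrbit e p))

IsOrbitSize : ℕ → ℕ → Set
IsOrbitSize n k = ∃ λ (e : LV n × LV n) → IsEdge e × OrbitSize e k

module Submission where

-- Write n = N = m + 1 and read positions
-- cyclically modulo N: Lucas strings are exactly the independent sets of
-- the N-cycle, so each dihedral map k ↦ k + a, k ↦ -k + a (with -1 ≡ m)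
-- induces an automorphism of Λ_N.  Conversely (module Automorphisms) every
-- automorphism is dihedral: it fixes 0 (other vertices have < N
-- neighbours), permutes the units e_j along some σ, σ keeps cyclic
-- neighbours adjacent (e_i, e_j have the common neighbour e_i + e_j iff
-- i, j are not adjacent) and is therefore dihedral, and an automorphism
-- fixing 0 and all e_j is the identity (induction on weight).  Hence
-- (module EdgeOrbits) the orbit of an edge consists of its N rotation and
-- N reflection images, each family injective: N edges if the reflection
-- k ↦ -k moves the edge like a rotation, 2N otherwise.  For n ≤ 4 every
-- edge is of the first kind (exhaustive check; Λ_1 has no edge), and for
-- n ≥ 5 the edges {0, e_0} and {e_2, e_0 + e_2} exhibit both kinds.

open import Defs

open import Data.Bool using (Bool; true; false; not; _∧_; _∨_; T)
open import Data.Bool.Properties using (T-≡; T-irrelevant; T?; ∧-comm; ∨-comm; ∨-identityʳ; ∨-zeroʳ; ¬-not)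
import Data.Bool.Properties as Bool
open import Data.Empty using (⊥; ⊥-elim)
open import Data.Fin using (Fin; toℕ; fromℕ<; punchOut)
import Data.Fin as Fin
import Data.Fin.Properties as Fin
open import Data.List using (List; []; _∷_; length; map; _++_; tabulate)
open import Data.List.Membership.Propositional using (_∈_)
open import Data.List.Membership.Propositional.Properties using (∈-map⁺; ∈-tabulate⁺; ∈-tabulate⁻; ∈-++⁺ˡ; ∈-++⁺ʳ; ∈-++⁻)
open import Data.List.Membership.Propositional.Properties.WithK using (unique∧set⇒bag)
open import Data.List.Properties using (length-tabulate; length-++)
open import Data.List.Relation.Binary.BagAndSetEquality using (∼bag⇒↭)
open import Data.List.Relation.Binary.Permutation.Propositional.Properties using (↭-length)
open import Data.List.Relation.Unary.All using (All; all?)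
import Data.List.Relation.Unary.All as All
open import Data.List.Relation.Unary.Any using (here)
open import Data.List.Relation.Unary.Unique.Propositional using (Unique)
import Data.List.Relation.Unary.Unique.Propositional.Properties as Unique
open import Data.Nat using (ℕ; zero; suc; _+_; _*_; _≤_; _<_; z≤n; s≤s; _%_; pred)
open import Data.Nat.DivMod
open import Data.Nat.Properties
open import Data.Nat.Tactic.RingSolver using (solve-∀)
open import Data.Product using (∃; _×_; _,_; proj₁; proj₂)
open import Data.Sum using (_⊎_; inj₁; inj₂; [_,_]′; swap)
open import Data.Vec using ([]; _∷_; lookup; last)
import Data.Vec.Properties as Vec
open import Function.Bundles using (_⇔_; Equivalence; mk⇔; mk↔ₛ′; Inverse)
open import Function.Construct.Composition using (_⇔-∘_)
open import Function.Construct.Symmetry using (⇔-sym)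
open import Relation.Binary.PropositionalEquality
open import Relation.Nullary using (¬_; Dec; yes; no)
open import Relation.Nullary.Decidable using (_⊎-dec_; does; dec-true; dec-false; does-⇔; toWitness; _×-dec_; _→-dec_)

true≢false : true ≢ false
true≢false ()

-- Reading a word at a natural-number position, `false` beyond its end.
-- Positions are then handled with ordinary arithmetic on ℕ.
bit : ∀ {n} → Word n → ℕ → Bool
bit [] _ = false
bit (x ∷ xs) zero = x
bit (x ∷ xs) (suc k) = bit xs k

bit-beyond : ∀ {n} (u : Word n) k → n ≤ k → bit u k ≡ false
bit-beyond [] k _ = refl
bit-beyond (x ∷ u) (suc k) (s≤s n≤k) = bit-beyond u k n≤k

lookup≡bit : ∀ {n} (u : Word n) (i : Fin n) → lookup u i ≡ bit u (toℕ i)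
lookup≡bit (x ∷ u) Fin.zero = refl
lookup≡bit (x ∷ u) (Fin.suc i) = lookup≡bit u i

bit-ext : ∀ {n} (u v : Word n) → (∀ k → k < n → bit u k ≡ bit v k) → u ≡ v
bit-ext [] [] _ = refl
bit-ext (x ∷ u) (y ∷ v) h =
  cong₂ _∷_ (h 0 (s≤s z≤n)) (bit-ext u v (λ k k<n → h (suc k) (s≤s k<n)))

wordOf : ∀ n → (ℕ → Bool) → Word n
wordOf zero f = []
wordOf (suc n) f = f 0 ∷ wordOf n (λ k → f (suc k))

bit-wordOf : ∀ n f k → k < n → bit (wordOf n f) k ≡ f k
bit-wordOf (suc n) f zero _ = refl
bit-wordOf (suc n) f (suc k) (s≤s k<n) = bit-wordOf n (λ k → f (suc k)) k k<n

bit-true⇒< : ∀ {n} (u : Word n) k → bit u k ≡ true → k < n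
bit-true⇒< {n} u k uk with k <? n
... | yes k<n = k<n
... | no k≮n with trans (sym uk) (bit-beyond u k (≮⇒≥ k≮n))
...   | ()

last≡bit : ∀ {m} (u : Word (suc m)) → last u ≡ bit u m
last≡bit (x ∷ []) = refl
last≡bit (x ∷ y ∷ u) = last≡bit (y ∷ u)

noConsec⇒ : ∀ {n} (u : Word n) → noConsec u ≡ true → ∀ k → bit u k ∧ bit u (suc k) ≡ false
noConsec⇒ [] _ k = refl
noConsec⇒ (x ∷ []) _ zero = ∧-comm x false
noConsec⇒ (x ∷ []) _ (suc k) = refl
noConsec⇒ (true ∷ true ∷ u) () k
noConsec⇒ (true ∷ false ∷ u) h zero = refl
noConsec⇒ (false ∷ y ∷ u) h zero = refl
noConsec⇒ (true ∷ false ∷ u) h (suc k) = noConsec⇒ (false ∷ u) h k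
noConsec⇒ (false ∷ y ∷ u) h (suc k) = noConsec⇒ (y ∷ u) h k

noConsec⇐ : ∀ {n} (u : Word n) → (∀ k → bit u k ∧ bit u (suc k) ≡ false) → noConsec u ≡ true
noConsec⇐ [] _ = refl
noConsec⇐ (x ∷ []) _ = refl
noConsec⇐ (true ∷ true ∷ u) h with h 0
... | ()
noConsec⇐ (true ∷ false ∷ u) h = noConsec⇐ (false ∷ u) (λ k → h (suc k))
noConsec⇐ (false ∷ y ∷ u) h = noConsec⇐ (y ∷ u) (λ k → h (suc k))

DiffersOnlyAt : ∀ {n} → Word n → Word n → ℕ → Set
DiffersOnlyAt {n} u v j = j < n × bit u j ≢ bit v j × (∀ k → k ≢ j → bit u k ≡ bit v k)

hamming≡0⇒ : ∀ {n} (u v : Word n) → hamming u v ≡ 0 → ∀ k → bit u k ≡ bit v k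
hamming≡0⇒ [] [] _ k = refl
hamming≡0⇒ (true ∷ u) (true ∷ v) h zero = refl
hamming≡0⇒ (false ∷ u) (false ∷ v) h zero = refl
hamming≡0⇒ (true ∷ u) (true ∷ v) h (suc k) = hamming≡0⇒ u v h k
hamming≡0⇒ (false ∷ u) (false ∷ v) h (suc k) = hamming≡0⇒ u v h k
hamming≡0⇒ (true ∷ u) (false ∷ v) () k
hamming≡0⇒ (false ∷ u) (true ∷ v) () k

hamming≡0⇐ : ∀ {n} (u v : Word n) → (∀ k → bit u k ≡ bit v k) → hamming u v ≡ 0
hamming≡0⇐ [] [] h = refl
hamming≡0⇐ (true ∷ u) (true ∷ v) h = hamming≡0⇐ u v (λ k → h (suc k))
hamming≡0⇐ (false ∷ u) (false ∷ v) h = hamming≡0⇐ u v (λ k → h (suc k))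
hamming≡0⇐ (true ∷ u) (false ∷ v) h with h 0
... | ()
hamming≡0⇐ (false ∷ u) (true ∷ v) h with h 0
... | ()

hamming≡1⇒ : ∀ {n} (u v : Word n) → hamming u v ≡ 1 → ∃ (DiffersOnlyAt u v)
hamming≡1⇒ [] [] ()
hamming≡1⇒ (true ∷ u) (true ∷ v) h = shiftDiff (hamming≡1⇒ u v h)
  where
  shiftDiff : ∃ (DiffersOnlyAt u v) → ∃ (DiffersOnlyAt (true ∷ u) (true ∷ v))
  shiftDiff (j , j<n , uj≢vj , rest) =
    suc j , s≤s j<n , uj≢vj , λ { zero _ → refl ; (suc k) k≢j → rest k (λ k≡j → k≢j (cong suc k≡j)) }
hamming≡1⇒ (false ∷ u) (false ∷ v) h = shiftDiff (hamming≡1⇒ u v h)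
  where
  shiftDiff : ∃ (DiffersOnlyAt u v) → ∃ (DiffersOnlyAt (false ∷ u) (false ∷ v))
  shiftDiff (j , j<n , uj≢vj , rest) =
    suc j , s≤s j<n , uj≢vj , λ { zero _ → refl ; (suc k) k≢j → rest k (λ k≡j → k≢j (cong suc k≡j)) }
hamming≡1⇒ (true ∷ u) (false ∷ v) h =
  0 , s≤s z≤n , (λ ()) , λ { zero k≢0 → ⊥-elim (k≢0 refl) ; (suc k) _ → hamming≡0⇒ u v (cong pred h) k }
hamming≡1⇒ (false ∷ u) (true ∷ v) h =
  0 , s≤s z≤n , (λ ()) , λ { zero k≢0 → ⊥-elim (k≢0 refl) ; (suc k) _ → hamming≡0⇒ u v (cong pred h) k }

hamming≡1⇐ : ∀ {n} (u v : Word n) j → DiffersOnlyAt u v j → hamming u v ≡ 1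
hamming≡1⇐ (true ∷ u) (true ∷ v) zero (_ , ne , _) = ⊥-elim (ne refl)
hamming≡1⇐ (false ∷ u) (false ∷ v) zero (_ , ne , _) = ⊥-elim (ne refl)
hamming≡1⇐ (true ∷ u) (false ∷ v) zero (_ , _ , rest) = cong suc (hamming≡0⇐ u v (λ k → rest (suc k) (λ ())))
hamming≡1⇐ (false ∷ u) (true ∷ v) zero (_ , _ , rest) = cong suc (hamming≡0⇐ u v (λ k → rest (suc k) (λ ())))
hamming≡1⇐ (true ∷ u) (true ∷ v) (suc j) (s≤s j<n , ne , rest) =
  hamming≡1⇐ u v j (j<n , ne , λ k k≢j → rest (suc k) (λ e → k≢j (suc-injective e)))
hamming≡1⇐ (false ∷ u) (false ∷ v) (suc j) (s≤s j<n , ne , rest) =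
  hamming≡1⇐ u v j (j<n , ne , λ k k≢j → rest (suc k) (λ e → k≢j (suc-injective e)))
hamming≡1⇐ (true ∷ u) (false ∷ v) (suc j) (_ , _ , rest) with rest 0 (λ ())
... | ()
hamming≡1⇐ (false ∷ u) (true ∷ v) (suc j) (_ , _ , rest) with rest 0 (λ ())
... | ()

differsOnlyAt-sym : ∀ {n} (u v : Word n) j → DiffersOnlyAt u v j → DiffersOnlyAt v u j
differsOnlyAt-sym u v j (j<n , ne , rest) = j<n , (λ e → ne (sym e)) , (λ k k≢j → sym (rest k k≢j))

differsOnlyAt-unique : ∀ {n} (u v : Word n) j j' → DiffersOnlyAt u v j → DiffersOnlyAt u v j' → j ≡ j'
differsOnlyAt-unique u v j j' (_ , ne , _) (_ , _ , rest') with j ≟ j'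
... | yes j≡j' = j≡j'
... | no j≢j' = ⊥-elim (ne (rest' j j≢j'))

differsOnlyAt-injective : ∀ {n} (w x y : Word n) q → DiffersOnlyAt w x q → DiffersOnlyAt w y q → x ≡ y
differsOnlyAt-injective w x y q (_ , ne₁ , rest₁) (_ , ne₂ , rest₂) = bit-ext x y sameBit
  where
  sameBit : ∀ k → k < _ → bit x k ≡ bit y k
  sameBit k _ with k ≟ q
  ... | yes refl = trans (¬-not (λ e → ne₁ (sym e))) (sym (¬-not (λ e → ne₂ (sym e))))
  ... | no k≢q = trans (sym (rest₁ k k≢q)) (rest₂ k k≢q)

commonNeighbour-positions : ∀ {n} (A X Y : Word n) i j q₁ q₂ → i ≢ j →
  bit X i ≢ bit Y i → bit X j ≢ bit Y j →
  DiffersOnlyAt A X q₁ → DiffersOnlyAt A Y q₂ → (q₁ ≡ i × q₂ ≡ j) ⊎ (q₁ ≡ j × q₂ ≡ i)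
commonNeighbour-positions A X Y i j q₁ q₂ i≢j Xi≢Yi Xj≢Yj (_ , _ , rest₁) (_ , _ , rest₂) =
  match (flippedAt i Xi≢Yi) (flippedAt j Xj≢Yj)
  where
  flippedAt : ∀ k → bit X k ≢ bit Y k → (q₁ ≡ k) ⊎ (q₂ ≡ k)
  flippedAt k Xk≢Yk with k ≟ q₁ | k ≟ q₂
  ... | yes k≡q₁ | _ = inj₁ (sym k≡q₁)
  ... | no _ | yes k≡q₂ = inj₂ (sym k≡q₂)
  ... | no k≢q₁ | no k≢q₂ = ⊥-elim (Xk≢Yk (trans (sym (rest₁ k k≢q₁)) (rest₂ k k≢q₂)))
  match : (q₁ ≡ i) ⊎ (q₂ ≡ i) → (q₁ ≡ j) ⊎ (q₂ ≡ j) → (q₁ ≡ i × q₂ ≡ j) ⊎ (q₁ ≡ j × q₂ ≡ i)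
  match (inj₁ a) (inj₁ b) = ⊥-elim (i≢j (trans (sym a) b))
  match (inj₁ a) (inj₂ b) = inj₁ (a , b)
  match (inj₂ a) (inj₁ b) = inj₂ (b , a)
  match (inj₂ a) (inj₂ b) = ⊥-elim (i≢j (trans (sym a) b))

vertex-ext : ∀ {n} (x y : LV n) → proj₁ x ≡ proj₁ y → x ≡ y
vertex-ext (u , t) (.u , t') refl = cong (u ,_) (T-irrelevant t t')

weight : ∀ {n} → Word n → ℕ
weight [] = 0
weight (true ∷ u) = suc (weight u)
weight (false ∷ u) = weight u

clear : ∀ {n} → Word n → ℕ → Word n
clear [] _ = []
clear (x ∷ u) zero = false ∷ u
clear (x ∷ u) (suc j) = x ∷ clear u j

bit-clear-same : ∀ {n} (u : Word n) j → bit (clear u j) j ≡ false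
bit-clear-same [] j = refl
bit-clear-same (x ∷ u) zero = refl
bit-clear-same (x ∷ u) (suc j) = bit-clear-same u j

bit-clear-other : ∀ {n} (u : Word n) j k → k ≢ j → bit (clear u j) k ≡ bit u k
bit-clear-other [] j k _ = refl
bit-clear-other (x ∷ u) zero zero k≢j = ⊥-elim (k≢j refl)
bit-clear-other (x ∷ u) zero (suc k) _ = refl
bit-clear-other (x ∷ u) (suc j) zero _ = refl
bit-clear-other (x ∷ u) (suc j) (suc k) k≢j = bit-clear-other u j k (λ e → k≢j (cong suc e))

weight-clear : ∀ {n} (u : Word n) j → bit u j ≡ true → weight u ≡ suc (weight (clear u j))
weight-clear (true ∷ u) zero _ = refl
weight-clear (true ∷ u) (suc j) uj = cong suc (weight-clear u j uj)
weight-clear (false ∷ u) (suc j) uj = weight-clear u j uj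

weight≡0⇒ : ∀ {n} (u : Word n) → weight u ≡ 0 → ∀ k → bit u k ≡ false
weight≡0⇒ [] _ k = refl
weight≡0⇒ (false ∷ u) w≡0 zero = refl
weight≡0⇒ (false ∷ u) w≡0 (suc k) = weight≡0⇒ u w≡0 k

weight≡suc⇒ : ∀ {n} (u : Word n) w → weight u ≡ suc w → ∃ λ j → bit u j ≡ true
weight≡suc⇒ (true ∷ u) w _ = 0 , refl
weight≡suc⇒ (false ∷ u) w e with weight≡suc⇒ u w e
... | j , uj = suc j , uj

differsOnlyAt-clear : ∀ {n} (u : Word n) j → bit u j ≡ true → DiffersOnlyAt u (clear u j) j
differsOnlyAt-clear u j uj =
  bit-true⇒< u j uj ,
  (λ e → true≢false (trans (sym uj) (trans e (bit-clear-same u j)))) ,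
  (λ k k≢j → sym (bit-clear-other u j k k≢j))

unique-sameMembers-length : ∀ {A : Set} {xs ys : List A} → Unique xs → Unique ys →
  (∀ x → x ∈ xs ⇔ x ∈ ys) → length xs ≡ length ys
unique-sameMembers-length u v same = ↭-length (∼bag⇒↭ (unique∧set⇒bag u v (λ {x} → same x)))

allWords : ∀ n → List (Word n)
allWords zero = [] ∷ []
allWords (suc n) = map (true ∷_) (allWords n) ++ map (false ∷_) (allWords n)

∈-allWords : ∀ {n} (u : Word n) → u ∈ allWords n
∈-allWords [] = here refl
∈-allWords (true ∷ u) = ∈-++⁺ˡ (∈-map⁺ (true ∷_) (∈-allWords u))
∈-allWords {suc n} (false ∷ u) = ∈-++⁺ʳ (map (true ∷_) (allWords n)) (∈-map⁺ (false ∷_) (∈-allWords u))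

∈-tabulate⇔ : ∀ {A : Set} {k} (f : Fin k → A) x → x ∈ tabulate f ⇔ (∃ λ i → f i ≡ x)
∈-tabulate⇔ f x = mk⇔ (λ x∈ → let (i , x≡) = ∈-tabulate⁻ x∈ in i , sym x≡) (λ { (i , refl) → ∈-tabulate⁺ i })

orbitSize-unique : ∀ {n} (e : LV n × LV n) k k' → OrbitSize e k → OrbitSize e k' → k ≡ k'
orbitSize-unique e k k' (L , L-unique , L-length , L-orbit) (L' , L'-unique , L'-length , L'-orbit) =
  trans (sym L-length) (trans (unique-sameMembers-length L-unique L'-unique (λ p → ⇔-sym (L'-orbit p) ⇔-∘ L-orbit p)) L'-length)

Below⇒bits : ∀ {n} (x y : LV n) → Below x y → ∀ k → bit (proj₁ x) k ≡ true → bit (proj₁ y) k ≡ true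
Below⇒bits (u , _) (v , _) u≤v k uk = begin
  bit v k                 ≡⟨ cong (bit v) (Fin.toℕ-fromℕ< k<n) ⟨
  bit v (toℕ i)           ≡⟨ lookup≡bit v i ⟨
  lookup v i              ≡⟨ u≤v i (trans (lookup≡bit u i) (trans (cong (bit u) (Fin.toℕ-fromℕ< k<n)) uk)) ⟩
  true                    ∎
  where
  open ≡-Reasoning
  k<n = bit-true⇒< u k uk
  i = fromℕ< k<n

bits⇒Below : ∀ {n} (x y : LV n) → (∀ k → bit (proj₁ x) k ≡ true → bit (proj₁ y) k ≡ true) → Below x y
bits⇒Below (u , _) (v , _) u≤v i ui = trans (lookup≡bit v i) (u≤v (toℕ i) (trans (sym (lookup≡bit u i)) ui))

Below-antisym : ∀ {n} (x y : LV n) → Below x y → Below y x → proj₁ x ≡ proj₁ y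
Below-antisym x y x≤y y≤x = bit-ext _ _ λ k _ → sameBit k (bit (proj₁ x) k) refl (bit (proj₁ y) k) refl
  where
  sameBit : ∀ k b → bit (proj₁ x) k ≡ b → ∀ c → bit (proj₁ y) k ≡ c → b ≡ c
  sameBit k true xk c yk = trans (sym (Below⇒bits x y x≤y k xk)) yk
  sameBit k false xk true yk = ⊥-elim (true≢false (trans (sym (Below⇒bits y x y≤x k yk)) xk))
  sameBit k false xk false yk = refl

adjacentToTwoClears : ∀ {n} (u A : Word n) i j → i ≢ j → bit u i ≡ true → bit u j ≡ true →
  hamming A (clear u i) ≡ 1 → hamming A (clear u j) ≡ 1 → A ≡ u ⊎ A ≡ clear (clear u i) j
adjacentToTwoClears u A i j i≢j ui uj Ai Aj
  with hamming≡1⇒ A (clear u i) Ai | hamming≡1⇒ A (clear u j) Aj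
... | q₁ , diff₁ | q₂ , diff₂
  with commonNeighbour-positions A (clear u i) (clear u j) i j q₁ q₂ i≢j differ-i differ-j diff₁ diff₂
  where
  ui-j : bit (clear u j) i ≡ true
  ui-j = trans (bit-clear-other u j i i≢j) ui
  uj-i : bit (clear u i) j ≡ true
  uj-i = trans (bit-clear-other u i j (λ e → i≢j (sym e))) uj
  differ-i : bit (clear u i) i ≢ bit (clear u j) i
  differ-i e = true≢false (trans (sym ui-j) (trans (sym e) (bit-clear-same u i)))
  differ-j : bit (clear u i) j ≢ bit (clear u j) j
  differ-j e = true≢false (trans (sym uj-i) (trans e (bit-clear-same u j)))
... | inj₁ (refl , refl) = inj₁ (differsOnlyAt-injective (clear u q₁) A u q₁
        (differsOnlyAt-sym A (clear u q₁) q₁ diff₁) (differsOnlyAt-sym u (clear u q₁) q₁ (differsOnlyAt-clear u q₁ ui)))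
... | inj₂ (refl , refl) = inj₂ (differsOnlyAt-injective (clear u q₂) A (clear (clear u q₂) q₁) q₁
        (differsOnlyAt-sym A (clear u q₂) q₁ diff₁)
        (differsOnlyAt-clear (clear u q₂) q₁ (trans (bit-clear-other u q₂ q₁ (λ e → i≢j (sym e))) uj)))

-- Arithmetic modulo N = m + 1, on representatives in ℕ.  The number m
-- plays the role of -1.
module Modular (m : ℕ) where

  N : ℕ
  N = suc m

  infix 4 _≈_
  _≈_ : ℕ → ℕ → Set
  x ≈ y = x % N ≡ y % N

  ≈-via : ∀ x y k l → x + k * N ≡ y + l * N → x ≈ y
  ≈-via x y k l e = trans (sym ([m+kn]%n≡m%n x k N)) (trans (cong (_% N) e) ([m+kn]%n≡m%n y l N))

  mod-≈ : ∀ x → x % N ≈ x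
  mod-≈ x = m%n%n≡m%n x N

  ≈-+ʳ : ∀ a b c → a ≈ b → a + c ≈ b + c
  ≈-+ʳ a b c a≈b = begin
    (a + c) % N               ≡⟨ %-distribˡ-+ a c N ⟩
    (a % N + c % N) % N       ≡⟨ cong (λ z → (z + c % N) % N) a≈b ⟩
    (b % N + c % N) % N       ≡⟨ %-distribˡ-+ b c N ⟨
    (b + c) % N               ∎
    where open ≡-Reasoning

  ≈-+ˡ : ∀ a b c → a ≈ b → c + a ≈ c + b
  ≈-+ˡ a b c a≈b = begin
    (c + a) % N   ≡⟨ cong (_% N) (+-comm c a) ⟩
    (a + c) % N   ≡⟨ ≈-+ʳ a b c a≈b ⟩
    (b + c) % N   ≡⟨ cong (_% N) (+-comm b c) ⟩
    (c + b) % N   ∎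
    where open ≡-Reasoning

  ≈-*ˡ : ∀ a b c → a ≈ b → c * a ≈ c * b
  ≈-*ˡ a b c a≈b = begin
    (c * a) % N               ≡⟨ %-distribˡ-* c a N ⟩
    ((c % N) * (a % N)) % N   ≡⟨ cong (λ z → ((c % N) * z) % N) a≈b ⟩
    ((c % N) * (b % N)) % N   ≡⟨ %-distribˡ-* c b N ⟨
    (c * b) % N               ∎
    where open ≡-Reasoning

  ≈-cancelˡ : ∀ c x y → c + x ≈ c + y → x ≈ y
  ≈-cancelˡ c x y e =
    trans (≈-via x (c + x + m * c) c 0 (minusC x))
          (trans (≈-+ʳ (c + x) (c + y) (m * c) e) (sym (≈-via y (c + y + m * c) c 0 (minusC y))))
    where
    -- adding m·c cancels c, as c + m·c = c·N
    identity : ∀ m c x → x + c * suc m ≡ c + x + m * c + 0 * suc m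
    identity = solve-∀
    minusC : ∀ x → x + c * N ≡ c + x + m * c + 0 * N
    minusC x = identity m c x

  neg-neg : ∀ x → m * (m * x) ≈ x
  neg-neg x = ≈-via _ x x (m * x) (identity m x)
    where
    identity : ∀ m x → m * (m * x) + x * suc m ≡ x + (m * x) * suc m
    identity = solve-∀

  suc-≈⇒ : ∀ x y → suc x ≈ y → x ≈ y + m
  suc-≈⇒ x y e = trans (sym ([m+n]%n≡m%n x N)) (trans (cong (_% N) (+-suc x m)) (≈-+ʳ (suc x) y m e))

  suc-cancel : ∀ x y → suc x ≈ suc y → x ≈ y
  suc-cancel x y e = trans (suc-≈⇒ x (suc y) e) (trans (cong (_% N) (sym (+-suc y m))) ([m+n]%n≡m%n y N))

  suc-mod : ∀ k → suc k ≈ suc (k % N)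
  suc-mod k = ≈-+ˡ k (k % N) 1 (sym (mod-≈ k))

  ≈-reduced⇒≡ : ∀ {x y} → x < N → y < N → x ≈ y → x ≡ y
  ≈-reduced⇒≡ x<N y<N e = trans (sym (m<n⇒m%n≡m x<N)) (trans e (m<n⇒m%n≡m y<N))

  suc≉ : 1 ≤ m → ∀ k → ¬ (suc k ≈ k)
  suc≉ 1≤m k e = 1≉0 (≈-cancelˡ k 1 0 (trans (cong (_% N) (+-comm k 1)) (trans e (cong (_% N) (sym (+-identityʳ k))))))
    where
    1≉0 : ¬ (1 ≈ 0)
    1≉0 e with trans (sym (m<n⇒m%n≡m (s≤s 1≤m))) e
    ... | ()

-- Lucas strings as independent sets of the N-cycle, and the dihedral
-- automorphisms of Λ_N.
module Dihedral (m : ℕ) where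

  open Modular m

  cyclicBit : Word N → ℕ → Bool
  cyclicBit u k = bit u (k % N)

  cyclicBit-≈ : ∀ u x y → x ≈ y → cyclicBit u x ≡ cyclicBit u y
  cyclicBit-≈ u x y x≈y = cong (bit u) x≈y

  cyclicBit-reduced : ∀ u {k} → k < N → cyclicBit u k ≡ bit u k
  cyclicBit-reduced u k<N = cong (bit u) (m<n⇒m%n≡m k<N)

  CyclicIndependent : Word N → Set
  CyclicIndependent u = ∀ k → cyclicBit u k ∧ cyclicBit u (suc k) ≡ false

  private
    isLucas-parts : ∀ a b → T (a ∧ not b) → a ≡ true × b ≡ false
    isLucas-parts true false _ = refl , refl

  isLucas⇒ : ∀ u → T (isLucas u) → CyclicIndependent u
  isLucas⇒ (x ∷ xs) t k with isLucas-parts (noConsec (x ∷ xs)) (x ∧ last (x ∷ xs)) t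
  ... | noConsec-u , wrap-u = atRemainder (m≤n⇒m<n∨m≡n (≤-pred (m%n<n k N)))
    where
    u = x ∷ xs
    r = k % N
    atRemainder : r < m ⊎ r ≡ m → bit u r ∧ bit u (suc k % N) ≡ false
    atRemainder (inj₁ r<m) = begin
      bit u r ∧ bit u (suc k % N)         ≡⟨ cong (λ i → bit u r ∧ bit u i) (trans (suc-mod k) (m<n⇒m%n≡m (s≤s r<m))) ⟩
      bit u r ∧ bit u (suc r)             ≡⟨ noConsec⇒ u noConsec-u r ⟩
      false                               ∎
      where open ≡-Reasoning
    atRemainder (inj₂ r≡m) = begin
      bit u r ∧ bit u (suc k % N)         ≡⟨ cong₂ (λ i j → bit u i ∧ bit u j) r≡m (trans (suc-mod k) (cong (λ i → suc i % N) r≡m)) ⟩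
      bit u m ∧ bit u (N % N)             ≡⟨ cong (λ i → bit u m ∧ bit u i) (n%n≡0 N) ⟩
      bit u m ∧ x                         ≡⟨ ∧-comm (bit u m) x ⟩
      x ∧ bit u m                         ≡⟨ cong (x ∧_) (last≡bit u) ⟨
      x ∧ last u                          ≡⟨ wrap-u ⟩
      false                               ∎
      where open ≡-Reasoning

  isLucas⇐ : ∀ u → CyclicIndependent u → T (isLucas u)
  isLucas⇐ (x ∷ xs) indep = Equivalence.from T-≡ (cong₂ (λ a b → a ∧ not b) noConsec-u wrap-u)
    where
    u = x ∷ xs
    consecutive : ∀ k → bit u k ∧ bit u (suc k) ≡ false
    consecutive k with k <? m
    ... | yes k<m = trans (cong₂ _∧_ (sym (cyclicBit-reduced u (s≤s (<⇒≤ k<m)))) (sym (cyclicBit-reduced u (s≤s k<m))))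
                          (indep k)
    ... | no k≮m = trans (cong (bit u k ∧_) (bit-beyond u (suc k) (s≤s (≮⇒≥ k≮m)))) (∧-comm (bit u k) false)
    noConsec-u : noConsec u ≡ true
    noConsec-u = noConsec⇐ u consecutive
    wrap-u : x ∧ last u ≡ false
    wrap-u = begin
      x ∧ last u                          ≡⟨ cong (x ∧_) (last≡bit u) ⟩
      x ∧ bit u m                         ≡⟨ ∧-comm x (bit u m) ⟩
      bit u m ∧ x                         ≡⟨ cong (λ i → bit u m ∧ bit u i) (n%n≡0 N) ⟨
      bit u m ∧ bit u (N % N)             ≡⟨ cong (_∧ bit u (N % N)) (sym (cyclicBit-reduced u (≤-refl {N}))) ⟩
      cyclicBit u m ∧ cyclicBit u N       ≡⟨ indep m ⟩
      false                               ∎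
      where open ≡-Reasoning

  CyclicNeighbours : ℕ → ℕ → Set
  CyclicNeighbours x y = (suc x ≈ y) ⊎ (suc y ≈ x)

  cyclicNeighbours? : ∀ x y → Dec (CyclicNeighbours x y)
  cyclicNeighbours? x y = (suc x % N ≟ y % N) ⊎-dec (suc y % N ≟ x % N)

  independent-neighbours : ∀ u → CyclicIndependent u → ∀ x y → CyclicNeighbours x y →
                           cyclicBit u x ∧ cyclicBit u y ≡ false
  independent-neighbours u indep x y (inj₁ sx≈y) =
    trans (cong (cyclicBit u x ∧_) (cyclicBit-≈ u y (suc x) (sym sx≈y))) (indep x)
  independent-neighbours u indep x y (inj₂ sy≈x) =
    trans (cong (_∧ cyclicBit u y) (cyclicBit-≈ u x (suc y) (sym sy≈x)))
          (trans (∧-comm (cyclicBit u (suc y)) (cyclicBit u y)) (indep y))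

  independent-mono : ∀ u v → (∀ k → bit v k ≡ true → bit u k ≡ true) → CyclicIndependent u → CyclicIndependent v
  independent-mono u v v⊆u indep k with cyclicBit v k in vk | cyclicBit v (suc k) in vk'
  ... | false | _ = refl
  ... | true | false = refl
  ... | true | true = ⊥-elim (true≢false (trans (sym (cong₂ _∧_ (v⊆u (k % N) vk) (v⊆u (suc k % N) vk'))) (indep k)))

  permute : (ℕ → ℕ) → Word N → Word N
  permute p u = wordOf N (λ k → cyclicBit u (p k))

  bit-permute : ∀ p u k → k < N → bit (permute p u) k ≡ cyclicBit u (p k)
  bit-permute p u k k<N = bit-wordOf N (λ k → cyclicBit u (p k)) k k<N

  Respects≈ : (ℕ → ℕ) → Set
  Respects≈ p = ∀ x y → x ≈ y → p x ≈ p y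

  cyclicBit-permute : ∀ p → Respects≈ p → ∀ u k → cyclicBit (permute p u) k ≡ cyclicBit u (p k)
  cyclicBit-permute p resp u k =
    trans (bit-permute p u (k % N) (m%n<n k N)) (cyclicBit-≈ u (p (k % N)) (p k) (resp (k % N) k (mod-≈ k)))

  permute-cong : ∀ p q → (∀ k → p k ≈ q k) → ∀ u → permute p u ≡ permute q u
  permute-cong p q p≈q u = bit-ext _ _ λ k k<N →
    trans (bit-permute p u k k<N) (trans (cyclicBit-≈ u (p k) (q k) (p≈q k)) (sym (bit-permute q u k k<N)))

  permute-∘ : ∀ p q → Respects≈ q → ∀ u → permute p (permute q u) ≡ permute (λ k → q (p k)) u
  permute-∘ p q resp u = bit-ext _ _ λ k k<N →
    trans (bit-permute p (permute q u) k k<N)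
          (trans (cyclicBit-permute q resp u (p k)) (sym (bit-permute (λ k → q (p k)) u k k<N)))

  permute-id : ∀ p → (∀ k → p k ≈ k) → ∀ u → permute p u ≡ u
  permute-id p p≈id u = bit-ext _ _ λ k k<N →
    trans (bit-permute p u k k<N) (trans (cyclicBit-≈ u (p k) k (p≈id k)) (cyclicBit-reduced u k<N))

  permute-independent : ∀ p → Respects≈ p → (∀ k → CyclicNeighbours (p k) (p (suc k))) →
                        ∀ u → CyclicIndependent u → CyclicIndependent (permute p u)
  permute-independent p resp adj u indep k =
    trans (cong₂ _∧_ (cyclicBit-permute p resp u k) (cyclicBit-permute p resp u (suc k)))
          (independent-neighbours u indep (p k) (p (suc k)) (adj k))

  permute-differsOnlyAt : ∀ p q → Respects≈ p → Respects≈ q → (∀ x → p (q x) ≈ x) → (∀ x → q (p x) ≈ x) →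
    ∀ u v j → DiffersOnlyAt u v j → DiffersOnlyAt (permute p u) (permute p v) (q j % N)
  permute-differsOnlyAt p q resp-p resp-q pq qp u v j (j<N , uj≢vj , rest) = m%n<n (q j) N , flipped , unchanged
    where
    pqj≈j : p (q j % N) ≈ j
    pqj≈j = trans (resp-p (q j % N) (q j) (mod-≈ (q j))) (pq j)
    atJ : ∀ w → bit (permute p w) (q j % N) ≡ bit w j
    atJ w = trans (bit-permute p w _ (m%n<n (q j) N)) (trans (cyclicBit-≈ w (p (q j % N)) j pqj≈j) (cyclicBit-reduced w j<N))
    flipped : bit (permute p u) (q j % N) ≢ bit (permute p v) (q j % N)
    flipped e = uj≢vj (trans (sym (atJ u)) (trans e (atJ v)))
    unchanged : ∀ k → k ≢ q j % N → bit (permute p u) k ≡ bit (permute p v) k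
    unchanged k k≢ with k <? N
    ... | no k≮N = trans (bit-beyond (permute p u) k (≮⇒≥ k≮N)) (sym (bit-beyond (permute p v) k (≮⇒≥ k≮N)))
    ... | yes k<N = trans (bit-permute p u k k<N) (trans (rest (p k % N) pk≢j) (sym (bit-permute p v k k<N)))
      where
      pk≢j : p k % N ≢ j
      pk≢j e = k≢ (trans (sym (m<n⇒m%n≡m k<N)) (trans (sym (qp k)) (resp-q (p k) j (trans e (sym (m<n⇒m%n≡m j<N))))))

  -- The dihedral maps of positions: k ↦ k + a (rotation, s = false) and
  -- k ↦ -k + a (reflection, s = true).
  dihedral : Bool → ℕ → ℕ → ℕ
  dihedral false a k = k + a
  dihedral true a k = m * k + a

  dihedral-respects : ∀ s a → Respects≈ (dihedral s a)
  dihedral-respects false a x y e = ≈-+ʳ x y a e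
  dihedral-respects true a x y e = ≈-+ʳ (m * x) (m * y) a (≈-*ˡ x y m e)

  reflection-step : ∀ a k → suc (dihedral true a (suc k)) ≈ dihedral true a k
  reflection-step a k = ≈-via _ _ 0 1 (identity m k a)
    where
    identity : ∀ m k a → suc (m * suc k + a) + 0 * suc m ≡ m * k + a + 1 * suc m
    identity = solve-∀

  dihedral-neighbours : ∀ s a k → CyclicNeighbours (dihedral s a k) (dihedral s a (suc k))
  dihedral-neighbours false a k = inj₁ refl
  dihedral-neighbours true a k = inj₂ (reflection-step a k)

  dihedral-shift-≈ : ∀ s a b k → a ≈ b → dihedral s a k ≈ dihedral s b k
  dihedral-shift-≈ false a b k = ≈-+ˡ a b k
  dihedral-shift-≈ true a b k = ≈-+ˡ a b (m * k)

  inverseShift : Bool → ℕ → ℕ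
  inverseShift false a = m * a
  inverseShift true a = a

  dihedral-inverseˡ : ∀ s a k → dihedral s a (dihedral s (inverseShift s a) k) ≈ k
  dihedral-inverseˡ false a k = ≈-via _ k 0 a (identity m k a)
    where
    identity : ∀ m k a → k + m * a + a + 0 * suc m ≡ k + a * suc m
    identity = solve-∀
  dihedral-inverseˡ true a k = ≈-via _ k k (m * k + a) (identity m k a)
    where
    identity : ∀ m k a → m * (m * k + a) + a + k * suc m ≡ k + (m * k + a) * suc m
    identity = solve-∀

  dihedral-inverseʳ : ∀ s a k → dihedral s (inverseShift s a) (dihedral s a k) ≈ k
  dihedral-inverseʳ false a k = ≈-via _ k 0 a (identity m k a)
    where
    identity : ∀ m k a → k + a + m * a + 0 * suc m ≡ k + a * suc m
    identity = solve-∀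
  dihedral-inverseʳ true a k = dihedral-inverseˡ true a k

  dihedralVertex : Bool → ℕ → LV N → LV N
  dihedralVertex s a (u , t) =
    permute (dihedral s a) u ,
    isLucas⇐ _ (permute-independent (dihedral s a) (dihedral-respects s a) (dihedral-neighbours s a) u (isLucas⇒ u t))

  dihedralVertex-inverseˡ : ∀ s a x → dihedralVertex s a (dihedralVertex s (inverseShift s a) x) ≡ x
  dihedralVertex-inverseˡ s a (u , t) = vertex-ext _ _
    (trans (permute-∘ (dihedral s a) (dihedral s (inverseShift s a)) (dihedral-respects s (inverseShift s a)) u)
           (permute-id (λ k → dihedral s (inverseShift s a) (dihedral s a k)) (dihedral-inverseʳ s a) u))

  dihedralVertex-inverseʳ : ∀ s a x → dihedralVertex s (inverseShift s a) (dihedralVertex s a x) ≡ x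
  dihedralVertex-inverseʳ s a (u , t) = vertex-ext _ _
    (trans (permute-∘ (dihedral s (inverseShift s a)) (dihedral s a) (dihedral-respects s a) u)
           (permute-id (λ k → dihedral s a (dihedral s (inverseShift s a) k)) (dihedral-inverseˡ s a) u))

  dihedralVertex-injective : ∀ s a x y → dihedralVertex s a x ≡ dihedralVertex s a y → x ≡ y
  dihedralVertex-injective s a x y e =
    trans (sym (dihedralVertex-inverseʳ s a x))
          (trans (cong (dihedralVertex s (inverseShift s a)) e) (dihedralVertex-inverseʳ s a y))

  dihedral-differsOnlyAt : ∀ s a u v j → DiffersOnlyAt u v j →
    DiffersOnlyAt (permute (dihedral s a) u) (permute (dihedral s a) v) (dihedral s (inverseShift s a) j % N)
  dihedral-differsOnlyAt s a = permute-differsOnlyAt (dihedral s a) (dihedral s (inverseShift s a))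
    (dihedral-respects s a) (dihedral-respects s (inverseShift s a)) (dihedral-inverseˡ s a) (dihedral-inverseʳ s a)

  dihedralVertex-adj : ∀ s a x y → Adj x y → Adj (dihedralVertex s a x) (dihedralVertex s a y)
  dihedralVertex-adj s a (u , _) (v , _) uv with hamming≡1⇒ u v uv
  ... | j , diff = hamming≡1⇐ _ _ _ (dihedral-differsOnlyAt s a u v j diff)

  dihedralAut : Bool → ℕ → Aut N
  dihedralAut s a = record
    { perm = mk↔ₛ′ (dihedralVertex s a) (dihedralVertex s a') (dihedralVertex-inverseˡ s a) (dihedralVertex-inverseʳ s a)
    ; preserve = λ x y → mk⇔ (dihedralVertex-adj s a x y) (reflect x y)
    }
    where
    a' = inverseShift s a
    reflect : ∀ x y → Adj (dihedralVertex s a x) (dihedralVertex s a y) → Adj x y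
    reflect x y h = subst₂ Adj (dihedralVertex-inverseʳ s a x) (dihedralVertex-inverseʳ s a y)
                      (dihedralVertex-adj s a' (dihedralVertex s a x) (dihedralVertex s a y) h)

  -- Successive positions go to neighbours under a dihedral map, all in
  -- the same direction; so the neighbours of d (k + 1) are d k and d (k + 2).
  neighbour-of-middle : ∀ x y z w → suc x ≈ y → suc y ≈ z → CyclicNeighbours y w → (w ≈ x) ⊎ (w ≈ z)
  neighbour-of-middle x y z w sx≈y sy≈z (inj₁ sy≈w) = inj₂ (trans (sym sy≈w) sy≈z)
  neighbour-of-middle x y z w sx≈y sy≈z (inj₂ sw≈y) = inj₁ (suc-cancel w x (trans sw≈y (sym sx≈y)))

  dihedral-neighbour : ∀ s a k w → CyclicNeighbours (dihedral s a (suc k)) w →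
                       (w ≈ dihedral s a k) ⊎ (w ≈ dihedral s a (suc (suc k)))
  dihedral-neighbour false a k w = neighbour-of-middle (k + a) (suc k + a) (suc (suc k) + a) w refl refl
  dihedral-neighbour true a k w nb =
    swap (neighbour-of-middle (dihedral true a (suc (suc k))) (dihedral true a (suc k)) (dihedral true a k) w (reflection-step a (suc k)) (reflection-step a k) nb)

  neighbour-preserving⇒dihedral : ∀ (σ : ℕ → ℕ) → (∀ i j → σ i ≈ σ j → i ≈ j) →
    (∀ k → CyclicNeighbours (σ k) (σ (suc k))) → ∃ λ s → ∀ k → σ k ≈ dihedral s (σ 0) k
  neighbour-preserving⇒dihedral σ σ-inj σ-nb = s , λ k → proj₁ (agreeFrom k)
    where
    start : ∃ λ s → σ 0 ≈ dihedral s (σ 0) 0 × σ 1 ≈ dihedral s (σ 0) 1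
    start with σ-nb 0
    ... | inj₁ forward = false , refl , sym forward
    ... | inj₂ backward = true , cong (λ z → (z + σ 0) % N) (sym (*-zeroʳ m)) ,
                          trans (suc-≈⇒ (σ 1) (σ 0) backward) (cong (_% N) (trans (+-comm (σ 0) m) (cong (_+ σ 0) (sym (*-identityʳ m)))))
    s = proj₁ start
    d = dihedral s (σ 0)
    neighbours-≈ : ∀ x x' y → x ≈ x' → CyclicNeighbours x y → CyclicNeighbours x' y
    neighbours-≈ x x' y x≈x' (inj₁ sx≈y) = inj₁ (trans (≈-+ˡ x' x 1 (sym x≈x')) sx≈y)
    neighbours-≈ x x' y x≈x' (inj₂ sy≈x) = inj₂ (trans sy≈x x≈x')
    agreeFrom : ∀ k → σ k ≈ d k × σ (suc k) ≈ d (suc k)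
    agreeFrom zero = proj₂ start
    agreeFrom (suc k) with agreeFrom k
    ... | σk≈dk , σk+1≈dk+1 = σk+1≈dk+1 , next
      where
      next : σ (suc (suc k)) ≈ d (suc (suc k))
      next with dihedral-neighbour s (σ 0) k _ (neighbours-≈ _ _ _ σk+1≈dk+1 (σ-nb (suc k)))
      ... | inj₂ forward = forward
      ... | inj₁ back = trans back (dihedral-respects s (σ 0) k (suc (suc k)) (sym k+2≈k))
        where
        k+2≈k : suc (suc k) ≈ k
        k+2≈k = σ-inj _ _ (trans back (sym σk≈dk))

-- The vertices 0, e_j and e_a + e_b of Λ_N, and the classification of
-- its automorphisms.  From here on N ≥ 2.
module Automorphisms (m : ℕ) (1≤m : 1 ≤ m) where

  open Modular m
  open Dihedral m

  _≈ᵇ_ : ℕ → ℕ → Bool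
  x ≈ᵇ y = does (x % N ≟ y % N)

  ≈ᵇ-true : ∀ x y → x ≈ y → x ≈ᵇ y ≡ true
  ≈ᵇ-true x y = dec-true (x % N ≟ y % N)

  ≈ᵇ-false : ∀ x y → ¬ x ≈ y → x ≈ᵇ y ≡ false
  ≈ᵇ-false x y = dec-false (x % N ≟ y % N)

  ≈ᵇ⇒ : ∀ x y → x ≈ᵇ y ≡ true → x ≈ y
  ≈ᵇ⇒ x y = doesTrue (x % N ≟ y % N)
    where
    doesTrue : ∀ {A : Set} (a? : Dec A) → does a? ≡ true → A
    doesTrue (yes a) _ = a

  ≈ᵇ-cong : ∀ x y x' y' → (x ≈ y ⇔ x' ≈ y') → x ≈ᵇ y ≡ x' ≈ᵇ y'
  ≈ᵇ-cong x y x' y' equiv = does-⇔ equiv (x % N ≟ y % N) (x' % N ≟ y' % N)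

  ≈ᵇ-mod : ∀ x y → (x % N) ≈ᵇ y ≡ x ≈ᵇ y
  ≈ᵇ-mod x y = cong (λ z → does (z ≟ y % N)) (mod-≈ x)

  zeroWord : Word N
  zeroWord = wordOf N (λ _ → false)

  bit-zero : ∀ k → bit zeroWord k ≡ false
  bit-zero k with k <? N
  ... | yes k<N = bit-wordOf N (λ _ → false) k k<N
  ... | no k≮N = bit-beyond zeroWord k (≮⇒≥ k≮N)

  zeroV : LV N
  zeroV = zeroWord , isLucas⇐ zeroWord (λ k → cong (_∧ cyclicBit zeroWord (suc k)) (bit-zero (k % N)))

  unitWord : ℕ → Word N
  unitWord j = wordOf N (λ k → k ≈ᵇ j)

  bit-unit : ∀ j k → k < N → bit (unitWord j) k ≡ k ≈ᵇ j
  bit-unit j k k<N = bit-wordOf N (λ k → k ≈ᵇ j) k k<N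

  cyclicBit-unit : ∀ j k → cyclicBit (unitWord j) k ≡ k ≈ᵇ j
  cyclicBit-unit j k = trans (bit-unit j (k % N) (m%n<n k N)) (≈ᵇ-mod k j)

  bit-unit-same : ∀ i → i < N → bit (unitWord i) i ≡ true
  bit-unit-same i i<N = trans (bit-unit i i i<N) (≈ᵇ-true i i refl)

  bit-unit-other : ∀ i j → i < N → j < N → i ≢ j → bit (unitWord j) i ≡ false
  bit-unit-other i j i<N j<N i≢j = trans (bit-unit j i i<N) (≈ᵇ-false i j (λ e → i≢j (≈-reduced⇒≡ i<N j<N e)))

  unit-independent : ∀ j → CyclicIndependent (unitWord j)
  unit-independent j k with (k ≈ᵇ j) in k≈j | (suc k ≈ᵇ j) in sk≈j
  ... | false | _ rewrite cyclicBit-unit j k | k≈j = refl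
  ... | true | false rewrite cyclicBit-unit j k | k≈j | cyclicBit-unit j (suc k) | sk≈j = refl
  ... | true | true = ⊥-elim (suc≉ 1≤m k (trans (≈ᵇ⇒ (suc k) j sk≈j) (sym (≈ᵇ⇒ k j k≈j))))

  unitV : ℕ → LV N
  unitV j = unitWord j , isLucas⇐ (unitWord j) (unit-independent j)

  unitV-cong : ∀ i j → i ≈ j → unitV i ≡ unitV j
  unitV-cong i j i≈j = vertex-ext _ _ (cong (λ z → wordOf N (λ k → does (k % N ≟ z))) i≈j)

  unitV-injective : ∀ i j → unitV i ≡ unitV j → i ≈ j
  unitV-injective i j e = trans (sym (mod-≈ i)) (≈ᵇ⇒ (i % N) j atI)
    where
    i<N = m%n<n i N
    atI : (i % N) ≈ᵇ j ≡ true
    atI = trans (sym (bit-unit j (i % N) i<N))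
                (trans (cong (λ x → bit (proj₁ x) (i % N)) (sym e)) (trans (bit-unit i (i % N) i<N) (trans (≈ᵇ-mod i i) (≈ᵇ-true i i refl))))

  zero-differsOnlyAt-unit : ∀ j → j < N → DiffersOnlyAt zeroWord (unitWord j) j
  zero-differsOnlyAt-unit j j<N = j<N , flipped , unchanged
    where
    flipped : bit zeroWord j ≢ bit (unitWord j) j
    flipped e = true≢false (trans (sym (bit-unit-same j j<N)) (trans (sym e) (bit-zero j)))
    unchanged : ∀ k → k ≢ j → bit zeroWord k ≡ bit (unitWord j) k
    unchanged k k≢j with k <? N
    ... | yes k<N = trans (bit-zero k) (sym (bit-unit-other k j k<N j<N k≢j))
    ... | no k≮N = trans (bit-zero k) (sym (bit-beyond (unitWord j) k (≮⇒≥ k≮N)))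

  zero-adj-unit : ∀ j → Adj zeroV (unitV j)
  zero-adj-unit j = hamming≡1⇐ zeroWord (unitWord j) (j % N)
    (subst (λ w → DiffersOnlyAt zeroWord w (j % N)) (cong proj₁ (unitV-cong (j % N) j (mod-≈ j)))
           (zero-differsOnlyAt-unit (j % N) (m%n<n j N)))

  zero-neighbour⇒unit : ∀ x → Adj zeroV x → ∃ λ q → q < N × x ≡ unitV q
  zero-neighbour⇒unit (v , t) h with hamming≡1⇒ zeroWord v h
  ... | q , diff@(q<N , _ , _) =
    q , q<N , vertex-ext _ _ (differsOnlyAt-injective zeroWord v (unitWord q) q diff (zero-differsOnlyAt-unit q q<N))

  successor-clear : ∀ (x : LV N) p → p < N → bit (proj₁ x) p ≡ true → bit (proj₁ x) (suc p % N) ≡ false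
  successor-clear (u , t) p p<N up =
    trans (sym (cong (_∧ cyclicBit u (suc p)) (trans (cyclicBit-reduced u p<N) up))) (isLucas⇒ u t p)

  -- A vertex w with a 1 at position p has no neighbour obtained by flipping
  -- position p + 1, so it has at most N - 1 neighbours: no N distinct
  -- vertices are adjacent to it.
  nonzero-fewNeighbours : ∀ (w : LV N) p → bit (proj₁ w) p ≡ true →
    (X : Fin N → LV N) → (∀ i → Adj w (X i)) → (∀ i j → X i ≡ X j → i ≡ j) → ⊥
  nonzero-fewNeighbours w p wp X adj X-inj = <-irrefl refl (Fin.injective⇒≤ {f = F} F-injective)
    where
    p<N = bit-true⇒< (proj₁ w) p wp
    p' = suc p % N
    p'<N = m%n<n (suc p) N
    flip : Fin N → ℕ
    flip i = proj₁ (hamming≡1⇒ (proj₁ w) (proj₁ (X i)) (adj i))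
    diff : ∀ i → DiffersOnlyAt (proj₁ w) (proj₁ (X i)) (flip i)
    diff i = proj₂ (hamming≡1⇒ (proj₁ w) (proj₁ (X i)) (adj i))
    flip≢p' : ∀ i → flip i ≢ p'
    flip≢p' i e with diff i
    ... | _ , flipped , rest = true≢false (trans (sym Xp') (successor-clear (X i) p p<N Xp))
      where
      Xp : bit (proj₁ (X i)) p ≡ true
      Xp = trans (sym (rest p λ p≡flip → suc≉ 1≤m p (trans (sym (trans p≡flip e)) (sym (m<n⇒m%n≡m p<N))))) wp
      Xp' : bit (proj₁ (X i)) p' ≡ true
      Xp' = trans (cong (bit (proj₁ (X i))) (sym e))
                  (trans (¬-not (λ e' → flipped (sym e'))) (cong not (trans (cong (bit (proj₁ w)) e) (successor-clear w p p<N wp))))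
    flip-injective : ∀ i j → flip i ≡ flip j → i ≡ j
    flip-injective i j e = X-inj i j (vertex-ext _ _
      (differsOnlyAt-injective (proj₁ w) (proj₁ (X i)) (proj₁ (X j)) (flip i) (diff i)
         (subst (DiffersOnlyAt (proj₁ w) (proj₁ (X j))) (sym e) (diff j))))
    -- removing the impossible position p' leaves N - 1 = m possible flips
    flipFin : Fin N → Fin N
    flipFin i = fromℕ< (proj₁ (diff i))
    toℕ-flipFin : ∀ i → toℕ (flipFin i) ≡ flip i
    toℕ-flipFin i = Fin.toℕ-fromℕ< (proj₁ (diff i))
    p'≢flip : ∀ i → fromℕ< p'<N ≢ flipFin i
    p'≢flip i e = flip≢p' i (sym (trans (sym (Fin.toℕ-fromℕ< p'<N)) (trans (cong toℕ e) (toℕ-flipFin i))))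
    F : Fin N → Fin m
    F i = punchOut (p'≢flip i)
    F-injective : ∀ {i j} → F i ≡ F j → i ≡ j
    F-injective {i} {j} e = flip-injective i j
      (trans (sym (toℕ-flipFin i)) (trans (cong toℕ (Fin.punchOut-injective (p'≢flip i) (p'≢flip j) e)) (toℕ-flipFin j)))

  pairWord : ℕ → ℕ → Word N
  pairWord a b = wordOf N (λ k → k ≈ᵇ a ∨ k ≈ᵇ b)

  bit-pair : ∀ a b k → k < N → bit (pairWord a b) k ≡ k ≈ᵇ a ∨ k ≈ᵇ b
  bit-pair a b = bit-wordOf N (λ k → k ≈ᵇ a ∨ k ≈ᵇ b)

  cyclicBit-pair : ∀ a b k → cyclicBit (pairWord a b) k ≡ k ≈ᵇ a ∨ k ≈ᵇ b
  cyclicBit-pair a b k = trans (bit-pair a b (k % N) (m%n<n k N))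
                               (cong₂ _∨_ (≈ᵇ-mod k a) (≈ᵇ-mod k b))

  pair-independent : ∀ a b → ¬ CyclicNeighbours a b → CyclicIndependent (pairWord a b)
  pair-independent a b apart k rewrite cyclicBit-pair a b k | cyclicBit-pair a b (suc k)
    with k ≈ᵇ a in k≈a | k ≈ᵇ b in k≈b | suc k ≈ᵇ a in sk≈a | suc k ≈ᵇ b in sk≈b
  ... | false | false | _ | _ = refl
  ... | true | _ | false | false = refl
  ... | false | true | false | false = refl
  ... | true | _ | true | _ = ⊥-elim (suc≉ 1≤m k (trans (≈ᵇ⇒ (suc k) a sk≈a) (sym (≈ᵇ⇒ k a k≈a))))
  ... | false | true | false | true = ⊥-elim (suc≉ 1≤m k (trans (≈ᵇ⇒ (suc k) b sk≈b) (sym (≈ᵇ⇒ k b k≈b))))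
  ... | true | _ | false | true =
    ⊥-elim (apart (inj₁ (trans (≈-+ˡ a k 1 (sym (≈ᵇ⇒ k a k≈a))) (≈ᵇ⇒ (suc k) b sk≈b))))
  ... | false | true | true | _ =
    ⊥-elim (apart (inj₂ (trans (≈-+ˡ b k 1 (sym (≈ᵇ⇒ k b k≈b))) (≈ᵇ⇒ (suc k) a sk≈a))))

  pairV : ∀ a b → ¬ CyclicNeighbours a b → LV N
  pairV a b apart = pairWord a b , isLucas⇐ _ (pair-independent a b apart)

  pairWord-comm : ∀ a b → pairWord a b ≡ pairWord b a
  pairWord-comm a b = bit-ext _ _ λ k k<N →
    trans (bit-pair a b k k<N) (trans (∨-comm (k ≈ᵇ a) (k ≈ᵇ b)) (sym (bit-pair b a k k<N)))

  pair-differsOnlyAt-unit : ∀ a b → ¬ a ≈ b → DiffersOnlyAt (pairWord a b) (unitWord a) (b % N)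
  pair-differsOnlyAt-unit a b a≉b = b<N , flipped , unchanged
    where
    b<N = m%n<n b N
    flipped : bit (pairWord a b) (b % N) ≢ bit (unitWord a) (b % N)
    flipped e = true≢false (begin
      true                                 ≡⟨ ∨-zeroʳ ((b % N) ≈ᵇ a) ⟨
      (b % N) ≈ᵇ a ∨ true                  ≡⟨ cong ((b % N) ≈ᵇ a ∨_) (trans (≈ᵇ-mod b b) (≈ᵇ-true b b refl)) ⟨
      (b % N) ≈ᵇ a ∨ (b % N) ≈ᵇ b          ≡⟨ bit-pair a b (b % N) b<N ⟨
      bit (pairWord a b) (b % N)           ≡⟨ e ⟩
      bit (unitWord a) (b % N)             ≡⟨ bit-unit a (b % N) b<N ⟩
      (b % N) ≈ᵇ a                         ≡⟨ trans (≈ᵇ-mod b a) (≈ᵇ-false b a (λ b≈a → a≉b (sym b≈a))) ⟩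
      false                                ∎)
      where open ≡-Reasoning
    unchanged : ∀ k → k ≢ b % N → bit (pairWord a b) k ≡ bit (unitWord a) k
    unchanged k k≢b with k <? N
    ... | no k≮N = trans (bit-beyond (pairWord a b) k (≮⇒≥ k≮N)) (sym (bit-beyond (unitWord a) k (≮⇒≥ k≮N)))
    ... | yes k<N = begin
      bit (pairWord a b) k                 ≡⟨ bit-pair a b k k<N ⟩
      k ≈ᵇ a ∨ k ≈ᵇ b                      ≡⟨ cong (k ≈ᵇ a ∨_) (≈ᵇ-false k b (λ k≈b → k≢b (trans (sym (m<n⇒m%n≡m k<N)) k≈b))) ⟩
      k ≈ᵇ a ∨ false                       ≡⟨ ∨-identityʳ (k ≈ᵇ a) ⟩
      k ≈ᵇ a                               ≡⟨ bit-unit a k k<N ⟨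
      bit (unitWord a) k                   ∎
      where open ≡-Reasoning

  no-adjacent-ones : ∀ (x : LV N) i j → i < N → j < N → bit (proj₁ x) i ≡ true → bit (proj₁ x) j ≡ true →
                     ¬ CyclicNeighbours i j
  no-adjacent-ones (u , t) i j i<N j<N ui uj nb = true≢false (begin
    true                                 ≡⟨ cong₂ _∧_ (trans (cyclicBit-reduced u i<N) ui) (trans (cyclicBit-reduced u j<N) uj) ⟨
    cyclicBit u i ∧ cyclicBit u j        ≡⟨ independent-neighbours u (isLucas⇒ u t) i j nb ⟩
    false                                ∎)
    where open ≡-Reasoning

  -- For cyclically neighbouring positions i ≠ j, the only common neighbour of
  -- e_i and e_j is 0 (otherwise it would be e_i + e_j).
  units-commonNeighbour : ∀ (x : LV N) i j → i < N → j < N → i ≢ j → CyclicNeighbours i j →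
                          Adj x (unitV i) → Adj x (unitV j) → x ≡ zeroV
  units-commonNeighbour (u , t) i j i<N j<N i≢j nb xi xj
    with hamming≡1⇒ u (unitWord i) xi | hamming≡1⇒ u (unitWord j) xj
  ... | q₁ , diff₁ | q₂ , diff₂
    with commonNeighbour-positions u (unitWord i) (unitWord j) i j q₁ q₂ i≢j
           (λ e → true≢false (trans (sym (bit-unit-same i i<N)) (trans e (bit-unit-other i j i<N j<N i≢j))))
           (λ e → true≢false (trans (sym (bit-unit-same j j<N)) (trans (sym e) (bit-unit-other j i j<N i<N (λ e' → i≢j (sym e'))))))
           diff₁ diff₂
  ... | inj₁ (refl , refl) = vertex-ext _ _
          (differsOnlyAt-injective (unitWord i) u zeroWord i
             (differsOnlyAt-sym u (unitWord i) i diff₁)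
             (differsOnlyAt-sym zeroWord (unitWord i) i (zero-differsOnlyAt-unit i i<N)))
  ... | inj₂ (refl , refl) = ⊥-elim (no-adjacent-ones (u , t) i j i<N j<N ui uj nb)
    where
    ui : bit u i ≡ true
    ui = trans (proj₂ (proj₂ diff₁) i i≢j) (bit-unit-same i i<N)
    uj : bit u j ≡ true
    uj = trans (proj₂ (proj₂ diff₂) j (λ e → i≢j (sym e))) (bit-unit-same j j<N)

  -- An automorphism g fixes 0 and permutes the unit vertices along a
  -- permutation σ of the positions that keeps cyclic neighbours adjacent.
  module Induced (g : Aut N) where

    g⁻¹ : LV N → LV N
    g⁻¹ = Inverse.from (Aut.perm g)

    act-inverse : ∀ y → act g (g⁻¹ y) ≡ y
    act-inverse = Inverse.strictlyInverseˡ (Aut.perm g)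

    inverse-act : ∀ x → g⁻¹ (act g x) ≡ x
    inverse-act = Inverse.strictlyInverseʳ (Aut.perm g)

    act-injective : ∀ x y → act g x ≡ act g y → x ≡ y
    act-injective x y e = trans (sym (inverse-act x)) (trans (cong g⁻¹ e) (inverse-act y))

    act-adj : ∀ x y → Adj x y → Adj (act g x) (act g y)
    act-adj x y = Equivalence.to (Aut.preserve g x y)

    inverse-adj : ∀ x y → Adj x y → Adj (g⁻¹ x) (g⁻¹ y)
    inverse-adj x y h = Equivalence.from (Aut.preserve g (g⁻¹ x) (g⁻¹ y))
                          (subst₂ Adj (sym (act-inverse x)) (sym (act-inverse y)) h)

    -- the images of the N units are N distinct neighbours of g 0, so g 0 = 0
    fixes-zero : act g zeroV ≡ zeroV
    fixes-zero with weight (proj₁ (act g zeroV)) in w≡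
    ... | zero = vertex-ext _ _ (bit-ext _ _ λ k _ → trans (weight≡0⇒ (proj₁ (act g zeroV)) w≡ k) (sym (bit-zero k)))
    ... | suc w with weight≡suc⇒ (proj₁ (act g zeroV)) w w≡
    ...   | p , g0p = ⊥-elim (nonzero-fewNeighbours (act g zeroV) p g0p (λ i → act g (unitV (toℕ i)))
                                (λ i → act-adj zeroV (unitV (toℕ i)) (zero-adj-unit (toℕ i))) units-distinct)
      where
      units-distinct : ∀ i j → act g (unitV (toℕ i)) ≡ act g (unitV (toℕ j)) → i ≡ j
      units-distinct i j e = Fin.toℕ-injective (≈-reduced⇒≡ (Fin.toℕ<n i) (Fin.toℕ<n j)
        (unitV-injective (toℕ i) (toℕ j) (act-injective _ _ e)))

    -- g maps e_j to the neighbour e_(σ j) of g 0 = 0 (kept opaque: only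
    -- its specification matters, and unfolding it slows checking down)
    opaque
      image-of-unit : ∀ j → ∃ λ q → q < N × act g (unitV j) ≡ unitV q
      image-of-unit j = zero-neighbour⇒unit _
        (subst (λ z → Adj z (act g (unitV j))) fixes-zero (act-adj zeroV (unitV j) (zero-adj-unit j)))

    σ : ℕ → ℕ
    σ j = proj₁ (image-of-unit j)

    act-unit : ∀ j → act g (unitV j) ≡ unitV (σ j)
    act-unit j = proj₂ (proj₂ (image-of-unit j))

    inverse-unit : ∀ j → g⁻¹ (unitV (σ j)) ≡ unitV j
    inverse-unit j = trans (cong g⁻¹ (sym (act-unit j))) (inverse-act (unitV j))

    σ-injective : ∀ i j → σ i ≈ σ j → i ≈ j
    σ-injective i j e = unitV-injective i j
      (act-injective _ _ (trans (act-unit i) (trans (unitV-cong (σ i) (σ j) e) (sym (act-unit j)))))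

    -- If σ k and σ (k + 1) were not neighbours, g⁻¹ (e_σk + e_σ(k+1)) would
    -- be a common neighbour of e_k and e_(k+1) other than 0.
    σ-neighbours : ∀ k → CyclicNeighbours (σ k) (σ (suc k))
    σ-neighbours k with cyclicNeighbours? (σ k) (σ (suc k))
    ... | yes nb = nb
    ... | no apart = ⊥-elim (nonzero (units-commonNeighbour x (k % N) (suc k % N) (m%n<n k N) (m%n<n (suc k) N)
                                        k≢k+1 k~k+1 (adjTo k refl adj-a) (adjTo (suc k) refl adj-b)))
      where
      a = σ k
      b = σ (suc k)
      a≉b : ¬ a ≈ b
      a≉b e = suc≉ 1≤m k (sym (σ-injective k (suc k) e))
      W = pairV a b apart
      x = g⁻¹ W
      adj-a : Adj W (unitV a)
      adj-a = hamming≡1⇐ (pairWord a b) (unitWord a) (b % N) (pair-differsOnlyAt-unit a b a≉b)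
      adj-b : Adj W (unitV b)
      adj-b = hamming≡1⇐ (pairWord a b) (unitWord b) (a % N)
                (subst (λ w → DiffersOnlyAt w (unitWord b) (a % N)) (pairWord-comm b a)
                       (pair-differsOnlyAt-unit b a (λ e → a≉b (sym e))))
      adjTo : ∀ j {q} → σ j ≡ q → Adj W (unitV q) → Adj x (unitV (j % N))
      adjTo j refl h = subst (Adj x) (trans (inverse-unit j) (unitV-cong j (j % N) (sym (mod-≈ j)))) (inverse-adj W _ h)
      k≢k+1 : k % N ≢ suc k % N
      k≢k+1 e = suc≉ 1≤m k (sym e)
      k~k+1 : CyclicNeighbours (k % N) (suc k % N)
      k~k+1 = inj₁ (trans (sym (suc-mod k)) (sym (mod-≈ (suc k))))
      nonzero : x ≢ zeroV
      nonzero x≡0 = true≢false (begin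
        true                         ≡⟨ trans (bit-pair a b (a % N) (m%n<n a N)) (cong (_∨ ((a % N) ≈ᵇ b)) (trans (≈ᵇ-mod a a) (≈ᵇ-true a a refl))) ⟨
        bit (pairWord a b) (a % N)   ≡⟨ cong (λ y → bit (proj₁ y) (a % N)) W≡0 ⟩
        bit zeroWord (a % N)         ≡⟨ bit-zero (a % N) ⟩
        false                        ∎)
        where
        open ≡-Reasoning
        W≡0 : W ≡ zeroV
        W≡0 = trans (sym (act-inverse W)) (trans (cong (act g) x≡0) fixes-zero)

  clearV : LV N → ℕ → LV N
  clearV (u , t) j = clear u j , isLucas⇐ (clear u j) (independent-mono u (clear u j) cleared⊆u (isLucas⇒ u t))
    where
    cleared⊆u : ∀ k → bit (clear u j) k ≡ true → bit u k ≡ true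
    cleared⊆u k e with k ≟ j
    ... | yes refl = ⊥-elim (true≢false (trans (sym e) (bit-clear-same u j)))
    ... | no k≢j = trans (sym (bit-clear-other u j k k≢j)) e

  clearV-adj : ∀ x j → bit (proj₁ x) j ≡ true → Adj x (clearV x j)
  clearV-adj (u , _) j uj = hamming≡1⇐ u (clear u j) j (differsOnlyAt-clear u j uj)

  single-one⇒unit : ∀ (x : LV N) j → bit (proj₁ x) j ≡ true → weight (clear (proj₁ x) j) ≡ 0 → x ≡ unitV j
  single-one⇒unit (u , t) j uj w≡0 = vertex-ext _ _
    (differsOnlyAt-injective zeroWord u (unitWord j) j
      (subst (λ w → DiffersOnlyAt w u j) cleared≡0 (differsOnlyAt-sym u (clear u j) j (differsOnlyAt-clear u j uj)))
      (zero-differsOnlyAt-unit j (bit-true⇒< u j uj)))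
    where
    cleared≡0 : clear u j ≡ zeroWord
    cleared≡0 = bit-ext _ _ λ k _ → trans (weight≡0⇒ (clear u j) w≡0 k) (sym (bit-zero k))

  -- A vertex x of weight ≥ 2 with 1s at i ≠ j is a
  -- common neighbour of its lower-weight (hence fixed) neighbours x - e_i
  -- and x - e_j, and the only other one, x - e_i - e_j, is itself fixed.
  rigidity : (f : LV N → LV N) → (∀ x y → f x ≡ f y → x ≡ y) → (∀ x y → Adj x y → Adj (f x) (f y)) →
             f zeroV ≡ zeroV → (∀ j → f (unitV j) ≡ unitV j) → ∀ x → f x ≡ x
  rigidity f f-inj f-adj f0 f-unit x = fixedUpTo (weight (proj₁ x)) x ≤-refl
    where
    twoOnes : ∀ x i j → i ≢ j → bit (proj₁ x) i ≡ true → bit (proj₁ x) j ≡ true →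
              f (clearV x i) ≡ clearV x i → f (clearV x j) ≡ clearV x j →
              f (clearV (clearV x i) j) ≡ clearV (clearV x i) j → f x ≡ x
    twoOnes x i j i≢j xi xj fX fY fZ = either (adjacentToTwoClears (proj₁ x) (proj₁ (f x)) i j i≢j xi xj
             (subst (Adj (f x)) fX (f-adj x _ (clearV-adj x i xi)))
             (subst (Adj (f x)) fY (f-adj x _ (clearV-adj x j xj))))
      where
      Z = clearV (clearV x i) j
      Zi : bit (proj₁ Z) i ≡ false
      Zi = trans (bit-clear-other (clear (proj₁ x) i) j i i≢j) (bit-clear-same (proj₁ x) i)
      either : proj₁ (f x) ≡ proj₁ x ⊎ proj₁ (f x) ≡ proj₁ Z → f x ≡ x
      either (inj₁ fx≡x) = vertex-ext _ _ fx≡x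
      either (inj₂ fx≡Z) = ⊥-elim (true≢false (trans (sym xi) (trans (cong (λ y → bit (proj₁ y) i) x≡Z) Zi)))
        where
        x≡Z : x ≡ Z
        x≡Z = f-inj x Z (trans (vertex-ext _ _ fx≡Z) (sym fZ))
    fixedAt : ∀ w → (∀ y → weight (proj₁ y) ≤ w → f y ≡ y) → ∀ x → weight (proj₁ x) ≡ suc w → f x ≡ x
    fixedAt w below x w≡ with weight≡suc⇒ (proj₁ x) w w≡
    ... | j , xj with w | trans (sym (weight-clear (proj₁ x) j xj)) w≡
    ...   | zero | wj≡0 = trans (cong f x≡e) (trans (f-unit j) (sym x≡e))
      where
      x≡e : x ≡ unitV j
      x≡e = single-one⇒unit x j xj (suc-injective wj≡0)
    ...   | suc w' | wj≡ with weight≡suc⇒ (clear (proj₁ x) j) w' (suc-injective wj≡)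
    ...     | i , xji = twoOnes x i j i≢j xi xj
                          (below _ (≤-reflexive wi≡)) (below _ (≤-reflexive (suc-injective wj≡)))
                          (below _ (≤-trans (≤-reflexive wij≡) (n≤1+n w')))
      where
      i≢j : i ≢ j
      i≢j refl = true≢false (trans (sym xji) (bit-clear-same (proj₁ x) i))
      xi : bit (proj₁ x) i ≡ true
      xi = trans (sym (bit-clear-other (proj₁ x) j i i≢j)) xji
      wi≡ : weight (clear (proj₁ x) i) ≡ suc w'
      wi≡ = suc-injective (trans (sym (weight-clear (proj₁ x) i xi)) (trans (weight-clear (proj₁ x) j xj) wj≡))
      wij≡ : weight (clear (clear (proj₁ x) i) j) ≡ w'
      wij≡ = suc-injective (trans (sym (weight-clear (clear (proj₁ x) i) j
                                         (trans (bit-clear-other (proj₁ x) i j (λ e → i≢j (sym e))) xj))) wi≡)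
    fixedUpTo : ∀ w x → weight (proj₁ x) ≤ w → f x ≡ x
    fixedUpTo zero x w≤0 = trans (cong f x≡0) (trans f0 (sym x≡0))
      where
      x≡0 : x ≡ zeroV
      x≡0 = vertex-ext _ _ (bit-ext _ _ λ k _ → trans (weight≡0⇒ (proj₁ x) (n≤0⇒n≡0 w≤0) k) (sym (bit-zero k)))
    fixedUpTo (suc w) x w≤ with m≤n⇒m<n∨m≡n w≤
    ... | inj₁ (s≤s w<) = fixedUpTo w x w<
    ... | inj₂ w≡ = fixedAt w (fixedUpTo w) x w≡

  dihedralVertex-zero : ∀ s a → dihedralVertex s a zeroV ≡ zeroV
  dihedralVertex-zero s a = vertex-ext _ _ (bit-ext _ _ λ k k<N →
    trans (bit-permute (dihedral s a) zeroWord k k<N) (trans (bit-zero (dihedral s a k % N)) (sym (bit-zero k))))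

  dihedralVertex-unit : ∀ s a y → dihedralVertex s a (unitV y) ≡ unitV (dihedral s (inverseShift s a) y)
  dihedralVertex-unit s a y = vertex-ext _ _ (bit-ext _ _ λ k k<N → begin
    bit (permute d (unitWord y)) k     ≡⟨ bit-permute d (unitWord y) k k<N ⟩
    cyclicBit (unitWord y) (d k)       ≡⟨ cyclicBit-unit y (d k) ⟩
    d k ≈ᵇ y                           ≡⟨ ≈ᵇ-cong (d k) y k (d⁻¹ y) (mk⇔ (forth k) (back k)) ⟩
    k ≈ᵇ d⁻¹ y                         ≡⟨ bit-unit (d⁻¹ y) k k<N ⟨
    bit (unitWord (d⁻¹ y)) k           ∎)
    where
    open ≡-Reasoning
    d = dihedral s a
    d⁻¹ = dihedral s (inverseShift s a)
    forth : ∀ k → d k ≈ y → k ≈ d⁻¹ y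
    forth k e = trans (sym (dihedral-inverseʳ s a k)) (dihedral-respects s (inverseShift s a) (d k) y e)
    back : ∀ k → k ≈ d⁻¹ y → d k ≈ y
    back k e = trans (dihedral-respects s a k (d⁻¹ y) e) (dihedral-inverseˡ s a y)

  -- Every automorphism of Λ_N is one of the dihedral automorphisms: undoing
  -- the dihedral map through σ leaves an automorphism fixing 0 and all e_j.
  classification : ∀ (g : Aut N) → ∃ λ s → ∃ λ a → ∀ x → act g x ≡ dihedralVertex s a x
  classification g = s , a' , λ x → begin
    act g x                                          ≡⟨ dihedralVertex-inverseʳ s a (act g x) ⟨
    dihedralVertex s a' (dihedralVertex s a (act g x)) ≡⟨ cong (dihedralVertex s a') (rigidity f f-inj f-adj f-zero f-unit x) ⟩
    dihedralVertex s a' x                            ∎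
    where
    open ≡-Reasoning
    open Induced g
    dihedralσ = neighbour-preserving⇒dihedral σ σ-injective σ-neighbours
    s = proj₁ dihedralσ
    a = σ 0
    a' = inverseShift s a
    f : LV N → LV N
    f x = dihedralVertex s a (act g x)
    f-inj : ∀ x y → f x ≡ f y → x ≡ y
    f-inj x y e = act-injective x y (dihedralVertex-injective s a (act g x) (act g y) e)
    f-adj : ∀ x y → Adj x y → Adj (f x) (f y)
    f-adj x y h = dihedralVertex-adj s a (act g x) (act g y) (act-adj x y h)
    f-zero : f zeroV ≡ zeroV
    f-zero = trans (cong (dihedralVertex s a) fixes-zero) (dihedralVertex-zero s a)
    f-unit : ∀ j → f (unitV j) ≡ unitV j
    f-unit j = begin
      dihedralVertex s a (act g (unitV j))   ≡⟨ cong (dihedralVertex s a) (act-unit j) ⟩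
      dihedralVertex s a (unitV (σ j))       ≡⟨ dihedralVertex-unit s a (σ j) ⟩
      unitV (dihedral s a' (σ j))            ≡⟨ unitV-cong _ j (trans (dihedral-respects s a' (σ j) _ (proj₂ dihedralσ j))
                                                                      (dihedral-inverseʳ s a j)) ⟩
      unitV j                                ∎

-- Orbits of Aut(Λ_N) on edges, with N ≥ 2.  An edge is stored as the pair
-- (u , v) with u below v, and is moved by the rotations and reflections.
module EdgeOrbits (m : ℕ) (1≤m : 1 ≤ m) where

  open Modular m
  open Dihedral m
  open Automorphisms m 1≤m

  VertexPair : Set
  VertexPair = LV N × LV N

  move : Bool → ℕ → VertexPair → VertexPair
  move s a (x , y) = dihedralVertex s a x , dihedralVertex s a y

  move-≈ : ∀ s a b e → a ≈ b → move s a e ≡ move s b e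
  move-≈ s a b (x , y) a≈b = cong₂ _,_ (sameVertex x) (sameVertex y)
    where
    sameVertex : ∀ x → dihedralVertex s a x ≡ dihedralVertex s b x
    sameVertex (u , _) = vertex-ext _ _ (permute-cong (dihedral s a) (dihedral s b) (λ k → dihedral-shift-≈ s a b k a≈b) u)

  rotate-move : ∀ c s a e → move false c (move s a e) ≡ move s (dihedral s a c) e
  rotate-move c s a (x , y) = cong₂ _,_ (composed x) (composed y)
    where
    shifted : ∀ s k → dihedral s a (dihedral false c k) ≡ dihedral s (dihedral s a c) k
    shifted false k = +-assoc k c a
    shifted true k = identity m k c a
      where
      identity : ∀ m k c a → m * (k + c) + a ≡ m * k + (m * c + a)
      identity = solve-∀
    composed : ∀ x → dihedralVertex false c (dihedralVertex s a x) ≡ dihedralVertex s (dihedral s a c) x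
    composed (u , _) = vertex-ext _ _
      (trans (permute-∘ (dihedral false c) (dihedral s a) (dihedral-respects s a) u)
             (permute-cong (λ k → dihedral s a (dihedral false c k)) (dihedral s (dihedral s a c)) (λ k → cong (_% N) (shifted s k)) u))

  below-dihedral : ∀ s a x y → Below x y → Below (dihedralVertex s a x) (dihedralVertex s a y)
  below-dihedral s a x@(u , _) y@(v , _) x≤y = bits⇒Below (dihedralVertex s a x) (dihedralVertex s a y) λ k uk →
    let k<N = bit-true⇒< (permute (dihedral s a) u) k uk in
    trans (bit-permute (dihedral s a) v k k<N)
          (Below⇒bits x y x≤y (dihedral s a k % N) (trans (sym (bit-permute (dihedral s a) u k k<N)) uk))

  move-edge : ∀ s a e → IsEdge e → IsEdge (move s a e)
  move-edge s a (x , y) (x~y , x≤y) = dihedralVertex-adj s a x y x~y , below-dihedral s a x y x≤y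

  reduce : ℕ → Fin N
  reduce a = fromℕ< (m%n<n a N)

  reduce-≈ : ∀ a → toℕ (reduce a) ≈ a
  reduce-≈ a = trans (cong (_% N) (Fin.toℕ-fromℕ< (m%n<n a N))) (mod-≈ a)

  -- The orbit of an edge e consists of its images under the 2N dihedral
  -- automorphisms; an automorphism cannot swap the ends of an edge, since
  -- it preserves the bitwise order.
  orbit-members : ∀ e → IsEdge e → ∀ p →
    (IsEdge p × InOrbit e p) ⇔ (∃ λ s → ∃ λ (a : Fin N) → move s (toℕ a) e ≡ p)
  orbit-members e@(x , y) (x~y , x≤y) p@(x' , y') = mk⇔ toMove fromMove
    where
    toMove : IsEdge p × InOrbit e p → ∃ λ s → ∃ λ (a : Fin N) → move s (toℕ a) e ≡ p
    toMove ((x'~y' , x'≤y') , g , images) = viaDihedral (classification g) images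
      where
      viaDihedral : (∃ λ s → ∃ λ a → ∀ z → act g z ≡ dihedralVertex s a z) →
                    (act g x ≡ x' × act g y ≡ y') ⊎ (act g x ≡ y' × act g y ≡ x') →
                    ∃ λ s → ∃ λ (a : Fin N) → move s (toℕ a) e ≡ p
      viaDihedral (s , a , g≡d) (inj₁ (gx , gy)) = s , reduce a ,
        trans (move-≈ s (toℕ (reduce a)) a e (reduce-≈ a)) (cong₂ _,_ (trans (sym (g≡d x)) gx) (trans (sym (g≡d y)) gy))
      viaDihedral (s , a , g≡d) (inj₂ (gx , gy)) = ⊥-elim (1+n≢0 (begin
        suc 0                          ≡⟨ x'~y' ⟨
        hamming (proj₁ x') (proj₁ y')  ≡⟨ cong (hamming (proj₁ x')) x'≡y' ⟨
        hamming (proj₁ x') (proj₁ x')  ≡⟨ hamming≡0⇐ (proj₁ x') (proj₁ x') (λ k → refl) ⟩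
        0                              ∎))
        where
        open ≡-Reasoning
        y'≤x' : Below y' x'
        y'≤x' = subst₂ Below (trans (sym (g≡d x)) gx) (trans (sym (g≡d y)) gy) (below-dihedral s a x y x≤y)
        x'≡y' : proj₁ x' ≡ proj₁ y'
        x'≡y' = Below-antisym x' y' x'≤y' y'≤x'
    fromMove : (∃ λ s → ∃ λ (a : Fin N) → move s (toℕ a) e ≡ p) → IsEdge p × InOrbit e p
    fromMove (s , a , moved) = subst (λ q → IsEdge q × InOrbit e q) moved
      (move-edge s (toℕ a) e (x~y , x≤y) , dihedralAut s (toℕ a) , inj₁ (refl , refl))
  -- Different shifts move an edge differently: the flipped position of the
  -- moved edge determines the shift modulo N.
  move-injective : ∀ e → IsEdge e → ∀ s (a b : Fin N) → move s (toℕ a) e ≡ move s (toℕ b) e → a ≡ b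
  move-injective ((u , tu) , (v , tv)) (u~v , _) s a b same with hamming≡1⇒ u v u~v
  ... | q , diff = Fin.toℕ-injective (≈-reduced⇒≡ (Fin.toℕ<n a) (Fin.toℕ<n b) (shift-determined s flips≈))
    where
    A = toℕ a
    B = toℕ b
    flipAfter : ∀ c → DiffersOnlyAt (permute (dihedral s c) u) (permute (dihedral s c) v) (dihedral s (inverseShift s c) q % N)
    flipAfter c = dihedral-differsOnlyAt s c u v q diff
    e = (u , tu) , (v , tv)
    sameU : proj₁ (proj₁ (move s A e)) ≡ proj₁ (proj₁ (move s B e))
    sameU = cong proj₁ (cong proj₁ same)
    sameV : proj₁ (proj₂ (move s A e)) ≡ proj₁ (proj₂ (move s B e))
    sameV = cong proj₁ (cong proj₂ same)
    flips≈ : dihedral s (inverseShift s A) q ≈ dihedral s (inverseShift s B) q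
    flips≈ = differsOnlyAt-unique (permute (dihedral s B) u) (permute (dihedral s B) v)
      (dihedral s (inverseShift s A) q % N) (dihedral s (inverseShift s B) q % N)
      (subst₂ (λ u' v' → DiffersOnlyAt u' v' (dihedral s (inverseShift s A) q % N)) sameU sameV (flipAfter A))
      (flipAfter B)
    shift-determined : ∀ s → dihedral s (inverseShift s A) q ≈ dihedral s (inverseShift s B) q → A ≈ B
    shift-determined false e =
      trans (sym (neg-neg A)) (trans (≈-*ˡ (m * A) (m * B) m (≈-cancelˡ q (m * A) (m * B) e)) (neg-neg B))
    shift-determined true e = ≈-cancelˡ (m * q) A B e

  ReflectionSymmetric : VertexPair → Set
  ReflectionSymmetric e = ∃ λ (a : Fin N) → move true 0 e ≡ move false (toℕ a) e

  vertexPair-≟ : (p q : VertexPair) → Dec (p ≡ q)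
  vertexPair-≟ ((u , _) , (v , _)) ((u' , _) , (v' , _))
    with Vec.≡-dec Bool._≟_ u u' | Vec.≡-dec Bool._≟_ v v'
  ... | yes u≡u' | yes v≡v' = yes (cong₂ _,_ (vertex-ext _ _ u≡u') (vertex-ext _ _ v≡v'))
  ... | no u≢u' | _ = no (λ e → u≢u' (cong proj₁ (cong proj₁ e)))
  ... | yes _ | no v≢v' = no (λ e → v≢v' (cong proj₁ (cong proj₂ e)))

  reflectionSymmetric? : ∀ e → Dec (ReflectionSymmetric e)
  reflectionSymmetric? e = Fin.any? (λ a → vertexPair-≟ (move true 0 e) (move false (toℕ a) e))

  symmetric⇒reflection-is-rotation : ∀ e → ReflectionSymmetric e → ∀ a → ∃ λ (b : Fin N) → move true a e ≡ move false (toℕ b) e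
  symmetric⇒reflection-is-rotation e (a₀ , sym₀) a = reduce c , (begin
    move true a e                                ≡⟨ move-≈ true a (dihedral true 0 (m * a)) e (trans (sym (neg-neg a)) (cong (_% N) (sym (+-identityʳ (m * (m * a)))))) ⟩
    move true (dihedral true 0 (m * a)) e        ≡⟨ rotate-move (m * a) true 0 e ⟨
    move false (m * a) (move true 0 e)           ≡⟨ cong (move false (m * a)) sym₀ ⟩
    move false (m * a) (move false (toℕ a₀) e)   ≡⟨ rotate-move (m * a) false (toℕ a₀) e ⟩
    move false c e                               ≡⟨ move-≈ false c (toℕ (reduce c)) e (sym (reduce-≈ c)) ⟩
    move false (toℕ (reduce c)) e                ∎)
    where
    open ≡-Reasoning
    c = dihedral false (toℕ a₀) (m * a)

  reflection-is-rotation⇒symmetric : ∀ e (a b : Fin N) → move true (toℕ b) e ≡ move false (toℕ a) e → ReflectionSymmetric e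
  reflection-is-rotation⇒symmetric e a b same = reduce c , (begin
    move true 0 e                                ≡⟨ move-≈ true 0 (dihedral true B B) e (≈-via 0 (m * B + B) B 0 (identity m B)) ⟩
    move true (dihedral true B B) e              ≡⟨ rotate-move B true B e ⟨
    move false B (move true B e)                 ≡⟨ cong (move false B) same ⟩
    move false B (move false (toℕ a) e)          ≡⟨ rotate-move B false (toℕ a) e ⟩
    move false c e                               ≡⟨ move-≈ false c (toℕ (reduce c)) e (sym (reduce-≈ c)) ⟩
    move false (toℕ (reduce c)) e                ∎)
    where
    open ≡-Reasoning
    B = toℕ b
    c = dihedral false (toℕ a) B
    -- b·N ≡ 0 modulo N
    identity : ∀ m b → 0 + b * suc m ≡ m * b + b + 0 * suc m
    identity = solve-∀

  rotationOf reflectionOf : VertexPair → Fin N → VertexPair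
  rotationOf e a = move false (toℕ a) e
  reflectionOf e a = move true (toℕ a) e

  rotationImages reflectionImages : VertexPair → List VertexPair
  rotationImages e = tabulate (rotationOf e)
  reflectionImages e = tabulate (reflectionOf e)

  rotationImages-unique : ∀ e → IsEdge e → Unique (rotationImages e)
  rotationImages-unique e e-edge = Unique.tabulate⁺ (λ {a} {b} → move-injective e e-edge false a b)

  allImages-unique : ∀ e → IsEdge e → ¬ ReflectionSymmetric e → Unique (rotationImages e ++ reflectionImages e)
  allImages-unique e e-edge asym = Unique.++⁺ (rotationImages-unique e e-edge)
    (Unique.tabulate⁺ (λ {a} {b} → move-injective e e-edge true a b)) disjoint
    where
    disjoint : ∀ {p} → ¬ (p ∈ rotationImages e × p ∈ reflectionImages e)
    disjoint (∈rot , ∈ref) =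
      let (a , p≡rot) = ∈-tabulate⁻ {f = rotationOf e} ∈rot
          (b , p≡ref) = ∈-tabulate⁻ {f = reflectionOf e} ∈ref
      in asym (reflection-is-rotation⇒symmetric e a b (trans (sym p≡ref) p≡rot))

  orbit-symmetric : ∀ e → IsEdge e → ReflectionSymmetric e → ∀ p → p ∈ rotationImages e ⇔ (IsEdge p × InOrbit e p)
  orbit-symmetric e e-edge symm p = ⇔-sym (orbit-members e e-edge p) ⇔-∘ (mk⇔ toDihedral fromDihedral ⇔-∘ ∈-tabulate⇔ (rotationOf e) p)
    where
    toDihedral : (∃ λ a → move false (toℕ a) e ≡ p) → ∃ λ s → ∃ λ (a : Fin N) → move s (toℕ a) e ≡ p
    toDihedral (a , moved) = false , a , moved
    fromDihedral : (∃ λ s → ∃ λ (a : Fin N) → move s (toℕ a) e ≡ p) → ∃ λ a → move false (toℕ a) e ≡ p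
    fromDihedral (false , a , moved) = a , moved
    fromDihedral (true , a , moved) =
      let (b , same) = symmetric⇒reflection-is-rotation e symm (toℕ a) in b , trans (sym same) moved

  orbit-asymmetric : ∀ e → IsEdge e → ∀ p → p ∈ rotationImages e ++ reflectionImages e ⇔ (IsEdge p × InOrbit e p)
  orbit-asymmetric e e-edge p = ⇔-sym (orbit-members e e-edge p) ⇔-∘ mk⇔ toDihedral fromDihedral
    where
    toDihedral : p ∈ rotationImages e ++ reflectionImages e → ∃ λ s → ∃ λ (a : Fin N) → move s (toℕ a) e ≡ p
    toDihedral p∈ = [ fromRotation , fromReflection ]′ (∈-++⁻ (rotationImages e) p∈)
      where
      fromRotation : p ∈ rotationImages e → ∃ λ s → ∃ λ (a : Fin N) → move s (toℕ a) e ≡ p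
      fromRotation ∈rot = let (a , p≡) = ∈-tabulate⁻ {f = rotationOf e} ∈rot in false , a , sym p≡
      fromReflection : p ∈ reflectionImages e → ∃ λ s → ∃ λ (a : Fin N) → move s (toℕ a) e ≡ p
      fromReflection ∈ref = let (a , p≡) = ∈-tabulate⁻ {f = reflectionOf e} ∈ref in true , a , sym p≡
    fromDihedral : (∃ λ s → ∃ λ (a : Fin N) → move s (toℕ a) e ≡ p) → p ∈ rotationImages e ++ reflectionImages e
    fromDihedral (false , a , moved) = subst (_∈ rotationImages e ++ reflectionImages e) moved (∈-++⁺ˡ (∈-tabulate⁺ {f = rotationOf e} a))
    fromDihedral (true , a , moved) = subst (_∈ rotationImages e ++ reflectionImages e) moved
                                        (∈-++⁺ʳ (rotationImages e) (∈-tabulate⁺ {f = reflectionOf e} a))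

  orbitSize-symmetric : ∀ e → IsEdge e → ReflectionSymmetric e → OrbitSize e N
  orbitSize-symmetric e e-edge symm =
    rotationImages e , rotationImages-unique e e-edge , length-tabulate (rotationOf e) , orbit-symmetric e e-edge symm

  orbitSize-asymmetric : ∀ e → IsEdge e → ¬ ReflectionSymmetric e → OrbitSize e (N + N)
  orbitSize-asymmetric e e-edge asym =
    rotationImages e ++ reflectionImages e , allImages-unique e e-edge asym ,
    trans (length-++ (rotationImages e)) (cong₂ _+_ (length-tabulate (rotationOf e)) (length-tabulate (reflectionOf e))) ,
    orbit-asymmetric e e-edge

  orbitSize-dichotomy : ∀ e → IsEdge e → ∀ k → OrbitSize e k →
    (ReflectionSymmetric e × k ≡ N) ⊎ (¬ ReflectionSymmetric e × k ≡ N + N)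
  orbitSize-dichotomy e e-edge k size = byCases (reflectionSymmetric? e)
    where
    byCases : Dec (ReflectionSymmetric e) → (ReflectionSymmetric e × k ≡ N) ⊎ (¬ ReflectionSymmetric e × k ≡ N + N)
    byCases (yes symm) = inj₁ (symm , orbitSize-unique e k N size (orbitSize-symmetric e e-edge symm))
    byCases (no asym) = inj₂ (asym , orbitSize-unique e k (N + N) size (orbitSize-asymmetric e e-edge asym))

  SymmetricWords : Word N → Word N → Set
  SymmetricWords u v = ∃ λ (a : Fin N) →
    permute (dihedral true 0) u ≡ permute (dihedral false (toℕ a)) u ×
    permute (dihedral true 0) v ≡ permute (dihedral false (toℕ a)) v

  EveryEdgeSymmetric : Set
  EveryEdgeSymmetric = All (λ u → All (λ v → T (isLucas u) → T (isLucas v) → hamming u v ≡ 1 → SymmetricWords u v)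
                                      (allWords N)) (allWords N)

  everyEdgeSymmetric? : Dec EveryEdgeSymmetric
  everyEdgeSymmetric? = all? (λ u → all? (λ v → T? (isLucas u) →-dec (T? (isLucas v) →-dec ((hamming u v ≟ 1) →-dec
    Fin.any? (λ a → Vec.≡-dec Bool._≟_ (permute (dihedral true 0) u) (permute (dihedral false (toℕ a)) u)
             ×-dec Vec.≡-dec Bool._≟_ (permute (dihedral true 0) v) (permute (dihedral false (toℕ a)) v)))))
    (allWords N)) (allWords N)

  everyEdge-symmetric : EveryEdgeSymmetric → ∀ e → IsEdge e → ReflectionSymmetric e
  everyEdge-symmetric check ((u , tu) , (v , tv)) (u~v , _) =
    let (a , sameU , sameV) = All.lookup (All.lookup check (∈-allWords u)) (∈-allWords v) tu tv u~v
    in a , cong₂ _,_ (vertex-ext (dihedralVertex true 0 (u , tu)) (dihedralVertex false (toℕ a) (u , tu)) sameU)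
                     (vertex-ext (dihedralVertex true 0 (v , tv)) (dihedralVertex false (toℕ a) (v , tv)) sameV)

module LargeCycle (j : ℕ) where

  m : ℕ
  m = 4 + j

  open Modular m
  open Dihedral m
  open Automorphisms m (s≤s z≤n)
  open EdgeOrbits m (s≤s z≤n)

  ≉-reduced : ∀ x y → x < N → y < N → x ≢ y → ¬ x ≈ y
  ≉-reduced x y x<N y<N x≢y x≈y = x≢y (≈-reduced⇒≡ x<N y<N x≈y)

  2<N : 2 < N
  2<N = s≤s (s≤s (s≤s z≤n))

  -- the reflection fixes 0 and sends 2 to N - 2 = 3 + j, which differs from 2
  reflect-0 : dihedral true 0 0 ≈ 0
  reflect-0 = cong (_% N) (trans (+-identityʳ (m * 0)) (*-zeroʳ m))

  reflect-2 : ¬ dihedral true 0 2 ≈ 2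
  reflect-2 e = ≉-reduced (3 + j) 2 (s≤s (s≤s (s≤s (s≤s (n≤1+n j))))) 2<N (λ ()) (trans (sym (≈-via (dihedral true 0 2) (3 + j) 0 1 (identity j))) e)
    where
    identity : ∀ j → (4 + j) * 2 + 0 + 0 * (5 + j) ≡ 3 + j + 1 * (5 + j)
    identity = solve-∀

  spokeEdge : VertexPair
  spokeEdge = zeroV , unitV 0

  spokeEdge-isEdge : IsEdge spokeEdge
  spokeEdge-isEdge = zero-adj-unit 0 , bits⇒Below zeroV (unitV 0) (λ k zk → ⊥-elim (true≢false (trans (sym zk) (bit-zero k))))

  spokeEdge-symmetric : ReflectionSymmetric spokeEdge
  spokeEdge-symmetric = Fin.zero , cong₂ _,_
    (trans (dihedralVertex-zero true 0) (sym (dihedralVertex-zero false 0)))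
    (trans (dihedralVertex-unit true 0 0)
           (trans (unitV-cong (dihedral true 0 0) (dihedral false (m * 0) 0) (cong (_% N) (+-identityʳ (m * 0))))
                  (sym (dihedralVertex-unit false 0 0))))

  0≁2 : ¬ CyclicNeighbours 0 2
  0≁2 (inj₁ 1≈2) = ≉-reduced 1 2 (s≤s (s≤s z≤n)) 2<N (λ ()) 1≈2
  0≁2 (inj₂ 3≈0) = ≉-reduced 3 0 (s≤s (s≤s (s≤s (s≤s z≤n)))) (s≤s z≤n) (λ ()) 3≈0

  pairEdge : VertexPair
  pairEdge = unitV 2 , pairV 0 2 0≁2

  pairEdge-isEdge : IsEdge pairEdge
  pairEdge-isEdge = adjacent , bits⇒Below (unitV 2) (pairV 0 2 0≁2) below
    where
    adjacent : Adj (unitV 2) (pairV 0 2 0≁2)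
    adjacent = hamming≡1⇐ (unitWord 2) (pairWord 0 2) 0
      (subst (λ w → DiffersOnlyAt (unitWord 2) w 0) (pairWord-comm 2 0)
        (differsOnlyAt-sym (pairWord 2 0) (unitWord 2) 0 (pair-differsOnlyAt-unit 2 0 (≉-reduced 2 0 2<N (s≤s z≤n) (λ ())))))
    below : ∀ k → bit (unitWord 2) k ≡ true → bit (pairWord 0 2) k ≡ true
    below k uk = let k<N = bit-true⇒< (unitWord 2) k uk in
      trans (bit-pair 0 2 k k<N) (trans (cong (k ≈ᵇ 0 ∨_) (trans (sym (bit-unit 2 k k<N)) uk)) (∨-zeroʳ (k ≈ᵇ 0)))

  -- Compare the two moved edges bitwise: at position 0 of the upper ends
  -- the rotation must shift by 0 or 2; the first is refuted at position 2
  -- and the second at position 0 of the lower ends.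
  pairEdge-asymmetric : ¬ ReflectionSymmetric pairEdge
  pairEdge-asymmetric (a , same) = [ shift0 , shift2 ]′ (∨-true (A ≈ᵇ 0) (A ≈ᵇ 2) upper0)
    where
    A = toℕ a
    lower : ∀ k → k < N → dihedral true 0 k ≈ᵇ 2 ≡ dihedral false A k ≈ᵇ 2
    lower k k<N = begin
      dihedral true 0 k ≈ᵇ 2                                   ≡⟨ cyclicBit-unit 2 (dihedral true 0 k) ⟨
      cyclicBit (unitWord 2) (dihedral true 0 k)               ≡⟨ bit-permute (dihedral true 0) (unitWord 2) k k<N ⟨
      bit (proj₁ (proj₁ (move true 0 pairEdge))) k             ≡⟨ cong (λ z → bit (proj₁ (proj₁ z)) k) same ⟩
      bit (proj₁ (proj₁ (move false A pairEdge))) k            ≡⟨ bit-permute (dihedral false A) (unitWord 2) k k<N ⟩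
      cyclicBit (unitWord 2) (dihedral false A k)              ≡⟨ cyclicBit-unit 2 (dihedral false A k) ⟩
      dihedral false A k ≈ᵇ 2                                  ∎
      where open ≡-Reasoning
    upper0 : A ≈ᵇ 0 ∨ A ≈ᵇ 2 ≡ true
    upper0 = begin
      A ≈ᵇ 0 ∨ A ≈ᵇ 2                                          ≡⟨ cyclicBit-pair 0 2 A ⟨
      cyclicBit (pairWord 0 2) (dihedral false A 0)            ≡⟨ bit-permute (dihedral false A) (pairWord 0 2) 0 (s≤s z≤n) ⟨
      bit (proj₁ (proj₂ (move false A pairEdge))) 0            ≡⟨ cong (λ z → bit (proj₁ (proj₂ z)) 0) same ⟨
      bit (proj₁ (proj₂ (move true 0 pairEdge))) 0             ≡⟨ bit-permute (dihedral true 0) (pairWord 0 2) 0 (s≤s z≤n) ⟩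
      cyclicBit (pairWord 0 2) (dihedral true 0 0)             ≡⟨ cyclicBit-pair 0 2 (dihedral true 0 0) ⟩
      dihedral true 0 0 ≈ᵇ 0 ∨ dihedral true 0 0 ≈ᵇ 2          ≡⟨ cong (_∨ (dihedral true 0 0 ≈ᵇ 2)) (≈ᵇ-true (dihedral true 0 0) 0 reflect-0) ⟩
      true                                                     ∎
      where open ≡-Reasoning
    ∨-true : ∀ x y → x ∨ y ≡ true → x ≡ true ⊎ y ≡ true
    ∨-true true y _ = inj₁ refl
    ∨-true false y y≡ = inj₂ y≡
    shift0 : A ≈ᵇ 0 ≡ true → ⊥
    shift0 A≈0 = true≢false (begin
      true                           ≡⟨ ≈ᵇ-true (dihedral false A 2) 2 (≈-+ˡ A 0 2 (≈ᵇ⇒ A 0 A≈0)) ⟨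
      dihedral false A 2 ≈ᵇ 2        ≡⟨ lower 2 2<N ⟨
      dihedral true 0 2 ≈ᵇ 2         ≡⟨ ≈ᵇ-false (dihedral true 0 2) 2 reflect-2 ⟩
      false                          ∎)
      where open ≡-Reasoning
    shift2 : A ≈ᵇ 2 ≡ true → ⊥
    shift2 A≈2 = true≢false (begin
      true                           ≡⟨ A≈2 ⟨
      dihedral false A 0 ≈ᵇ 2        ≡⟨ lower 0 (s≤s z≤n) ⟨
      dihedral true 0 0 ≈ᵇ 2         ≡⟨ ≈ᵇ-false (dihedral true 0 0) 2 (λ e → ≉-reduced 0 2 (s≤s z≤n) 2<N (λ ()) (trans (sym reflect-0) e)) ⟩
      false                          ∎)
      where open ≡-Reasoning

orbitSizes : ∀ m (1≤m : 1 ≤ m) → ∀ k → IsOrbitSize (suc m) k → k ≡ suc m ⊎ k ≡ 2 * suc m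
orbitSizes m 1≤m k (e , e-edge , size) = bySize (EdgeOrbits.orbitSize-dichotomy m 1≤m e e-edge k size)
  where
  bySize : ∀ {A B : Set} → (A × k ≡ suc m) ⊎ (B × k ≡ suc m + suc m) → k ≡ suc m ⊎ k ≡ 2 * suc m
  bySize (inj₁ (_ , k≡n)) = inj₁ k≡n
  bySize (inj₂ (_ , k≡n+n)) = inj₂ (trans k≡n+n (cong (suc m +_) (sym (+-identityʳ (suc m)))))

noDoubleOrbit : ∀ m (1≤m : 1 ≤ m) → (∀ e → IsEdge e → EdgeOrbits.ReflectionSymmetric m 1≤m e) →
                ¬ IsOrbitSize (suc m) (2 * suc m)
noDoubleOrbit m 1≤m symmetric (e , e-edge , size) =
  bySize (EdgeOrbits.orbitSize-dichotomy m 1≤m e e-edge (2 * suc m) size)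
  where
  open EdgeOrbits m 1≤m using (ReflectionSymmetric)
  bySize : (ReflectionSymmetric e × 2 * suc m ≡ suc m) ⊎ (¬ ReflectionSymmetric e × 2 * suc m ≡ suc m + suc m) → ⊥
  bySize (inj₁ (_ , 2n≡n)) = 1+n≢0 (+-cancelˡ-≡ (suc m) (suc m + 0) 0 (trans 2n≡n (sym (+-identityʳ (suc m)))))
  bySize (inj₂ (asym , _)) = asym (symmetric e e-edge)

symmetric-n=2 : ∀ e → IsEdge e → EdgeOrbits.ReflectionSymmetric 1 (s≤s z≤n) e
symmetric-n=2 = EdgeOrbits.everyEdge-symmetric 1 (s≤s z≤n) (toWitness {a? = EdgeOrbits.everyEdgeSymmetric? 1 (s≤s z≤n)} _)
symmetric-n=3 : ∀ e → IsEdge e → EdgeOrbits.ReflectionSymmetric 2 (s≤s z≤n) e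
symmetric-n=3 = EdgeOrbits.everyEdge-symmetric 2 (s≤s z≤n) (toWitness {a? = EdgeOrbits.everyEdgeSymmetric? 2 (s≤s z≤n)} _)
symmetric-n=4 : ∀ e → IsEdge e → EdgeOrbits.ReflectionSymmetric 3 (s≤s z≤n) e
symmetric-n=4 = EdgeOrbits.everyEdge-symmetric 3 (s≤s z≤n) (toWitness {a? = EdgeOrbits.everyEdgeSymmetric? 3 (s≤s z≤n)} _)

bothSizes : ∀ j → IsOrbitSize (5 + j) (5 + j) × IsOrbitSize (5 + j) (2 * (5 + j))
bothSizes j =
  (spokeEdge , spokeEdge-isEdge , orbitSize-symmetric spokeEdge spokeEdge-isEdge spokeEdge-symmetric) ,
  (pairEdge , pairEdge-isEdge ,
   subst (OrbitSize pairEdge) (cong ((5 + j) +_) (sym (+-identityʳ (5 + j))))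
         (orbitSize-asymmetric pairEdge pairEdge-isEdge pairEdge-asymmetric))
  where
  open LargeCycle j
  open EdgeOrbits (4 + j) (s≤s z≤n)

noEdges-n=1 : ∀ k → ¬ IsOrbitSize 1 k
noEdges-n=1 k (((true ∷ [] , ()) , _) , _)
noEdges-n=1 k (((false ∷ [] , _) , (true ∷ [] , ())) , _)
noEdges-n=1 k (((false ∷ [] , _) , (false ∷ [] , _)) , (() , _) , _)

theorem5p10 : ∀ (n : ℕ) → 1 ≤ n →
    (∀ k → IsOrbitSize n k → (k ≡ n ⊎ k ≡ 2 * n))
    × ((IsOrbitSize n n × IsOrbitSize n (2 * n)) ⇔ (5 ≤ n))
theorem5p10 1 _ =
  (λ k size → ⊥-elim (noEdges-n=1 k size)) , mk⇔ (λ sizes → ⊥-elim (noEdges-n=1 1 (proj₁ sizes))) (λ { (s≤s ()) })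
theorem5p10 2 _ =
  orbitSizes 1 (s≤s z≤n) , mk⇔ (λ sizes → ⊥-elim (noDoubleOrbit 1 (s≤s z≤n) symmetric-n=2 (proj₂ sizes))) (λ { (s≤s (s≤s ())) })
theorem5p10 3 _ =
  orbitSizes 2 (s≤s z≤n) , mk⇔ (λ sizes → ⊥-elim (noDoubleOrbit 2 (s≤s z≤n) symmetric-n=3 (proj₂ sizes))) (λ { (s≤s (s≤s (s≤s ()))) })
theorem5p10 4 _ =
  orbitSizes 3 (s≤s z≤n) , mk⇔ (λ sizes → ⊥-elim (noDoubleOrbit 3 (s≤s z≤n) symmetric-n=4 (proj₂ sizes))) (λ { (s≤s (s≤s (s≤s (s≤s ())))) })
theorem5p10 (suc (suc (suc (suc (suc j))))) _ =
  orbitSizes (4 + j) (s≤s z≤n) , mk⇔ (λ _ → s≤s (s≤s (s≤s (s≤s (s≤s z≤n))))) (λ _ → bothSizes j)
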